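{- Let $w \in W_{af}$, and let $\gamma = (\mathbf{a}_0, \mathbf{a}_1, \dots, \mathbf{a}_m)$ and $\gamma' = (\mathbf{a}_0, \mathbf{a}'_1, \dots, \mathbf{a}'_{n})$ be any two alcove walks from the base alcove $\mathbf{a}_0$ to the alcove $\mathbf{w}=w\mathbf{a}_0$ (not necessarily of minimal length, and possibly of different lengths). Then for every $v \in W_{af}$, \[ \sum_{\substack{\varepsilon\in\{0,1\}^m,\ |\varepsilon| = \ell(v) \\ w^\varepsilon = v}} \Psi_\gamma^\varepsilon \;=\; \sum_{\substack{\varepsilon'\in\{0,1\}^n,\ |\varepsilon'| = \ell(v) \\ w^{\varepsilon'} = v}} \Psi_{\gamma'}^{\varepsilon'}, \] where on the left $w^\varepsilon$ is formed from the expression $\operatorname{type}(\gamma)$ and on the right $w^{\varepsilon'}$ from the expression $\operatorname{type}(\gamma')$.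
   Context: Let $(I_{af},A_{af})$ be an affine Cartan datum with generalized Cartan matrix $A_{af}=(a_{ij})$, $|I_{af}|=n$, $0\in I_{af}$, $I_0=I_{af}\setminus\{0\}$. The affine Weyl group $W_{af}$ is generated by $s_i$, $i\in I_{af}$, with relations $s_i^2=1$, $(s_is_j)^{m_{ij}}=1$ (where $m_{ij}=2,3,4,6$ according as $a_{ij}a_{ji}=0,1,2,3$); $\ell$ denotes Coxeter length. Simple affine roots $\alpha_i$ and coroots $\alpha_i^\vee$ ($i\in I_{af}$) satisfy $\langle\alpha_i^\vee,\alpha_j\rangle=a_{ij}$, and $W_{af}$ acts on the root lattice by $s_i\mu=\mu-\langle\alpha_i^\vee,\mu\rangle\alpha_i$. The real affine roots are $R_{af}=\{w\alpha_i\}$, with positive roots $R^+_{af}=R_{af}\cap\sum_i\mathbb{Z}_{\ge0}\alpha_i$ and $R^-_{af}=-R^+_{af}$. Let $R$ be the finite root system of $(I_0,A_0)$ with positive roots $R^+$ and highest root $\theta$, and $\delta=\alpha_0+\theta$; then $R_{af}=\{\alpha+k\delta: \alpha\in R, k\in\mathbb{Z}\}$. All products of affine roots are regarded as elements of $\mathbb{Z}[\alpha_0,\dots,\alpha_{n-1}]$ via $\delta=\alpha_0+\theta$. Geometry: $V^*=X^\vee\otimes\mathbb{R}$ ($X^\vee$ the finite coroot lattice); for $\alpha+k\delta\in R_{af}$ the hyperplane $H_{\alpha+k\delta}=\{x\in V^*:\langle x,\alpha\rangle=k\}$ (so $H_\beta=H_{ -\beta}$), and $W_{af}$ acts on $V^*$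 by affine transformations with $s_\beta$ the reflection across $H_\beta$. Alcoves are closures of connected components of the complement of all these hyperplanes; the base alcove $\mathbf{a}_0$ is the alcove whose walls are the $H_{\alpha_i}$, $i\in I_{af}$; $W_{af}$ acts simply transitively on alcoves and $w\in W_{af}$ is identified with $\mathbf{w}=w\mathbf{a}_0$. For $u\in W_{af}$, $i\in I_{af}$, the alcoves $u\mathbf{a}_0$ and $us_i\mathbf{a}_0$ share a codimension-one face (panel), said to be of type $i$, lying in the hyperplane $H_{u\alpha_i}$. An alcove walk $\gamma=(\mathbf{a}_0,\mathbf{a}_1,\dots,\mathbf{a}_m)$ is a sequence of alcoves with $\mathbf{a}_{j-1}\neq\mathbf{a}_j$ sharing a panel for each $j$; if $\mathbf{a}_{j-1}=u\mathbf{a}_0$ and $\mathbf{a}_j=us_{i_j}\mathbf{a}_0$, the type of $\gamma$ is the expression $\operatorname{type}(\gamma)=s_{i_1}\cdots s_{i_m}$, and $\gamma$ is a walk to $\mathbf{w}$ where $w=s_{i_1}\cdots s_{i_m}$. Step $j$ crosses the hyperplane $H_{u\alpha_{i_j}}$; it is a forward step if $\ell(u)<\ell(us_{i_j})$ and a backward step otherwise; step $j$ is labelled by the root $\beta_j\in\{\pm u\alpha_{i_j}\}$ lying in $R^+_{af}$ for a forward step and in $R^-_{af}$ for a backward step. A mask on $\gamma$ is $\varepsilon=(\varepsilon_1,\dots,\varepsilon_m)\in\{0,1\}^m$; its support is $|\varepsilon|=\#\{j:\varepsilon_j=1\}$, and $w^\varepsilon=s_{i_1}^{\varepsilon_1}\cdots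 s_{i_m}^{\varepsilon_m}\in W_{af}$. Set $\Psi^\varepsilon_\gamma=\prod_{j:\varepsilon_j=1}\beta_j$ (equal to $1$ if $\varepsilon=0$). -}

module Defs where

open import Data.Nat as ℕ using (ℕ; zero; suc; _≡ᵇ_)
open import Data.Integer as ℤ using (ℤ; +_; _+_; _*_; _-_; -_; _≤_)
open import Data.Fin using (Fin; zero; suc; toℕ)
open import Data.List using (List; []; _∷_; _++_; length; take; lookup; map; foldr)
open import Data.Vec using (Vec; []; _∷_)
open import Data.Bool using (Bool; true; false; if_then_else_; _∧_)
open import Data.Maybe using (Maybe; just; nothing)
open import Data.Product using (Σ; _×_; _,_; ∃)
open import Data.Sum using (_⊎_)
open import Relation.Binary.PropositionalEquality using (_≡_)
open import Relation.Nullary using (¬_; Dec; does)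

∑ : ∀ {m} → (Fin m → ℤ) → ℤ
∑ {zero} f = + 0
∑ {suc m} f = f zero + ∑ (λ j → f (suc j))

-- root lattice ⊕_{i ∈ I_af} ℤ α_i, with I_af = Fin N (node 0 = zero);
-- an element μ is its coefficient vector
Lat : ℕ → Set
Lat N = Fin N → ℤ

e : ∀ {N} → Fin N → Lat N
e zero zero = + 1
e zero (suc _) = + 0
e (suc i) zero = + 0
e (suc i) (suc j) = e i j

Matrix : ℕ → Set
Matrix N = Fin N → Fin N → ℤ

rep : ∀ {X : Set} → ℕ → List X → List X
rep zero xs = []
rep (suc m) xs = xs ++ rep m xs

-- m_ij from a_ij a_ji = 0,1,2,3  ↦  2,3,4,6 ; otherwise m_ij = ∞ (no relation)
coxM : ℤ → Maybe ℕ
coxM (+ 0) = just 2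
coxM (+ 1) = just 3
coxM (+ 2) = just 4
coxM (+ 3) = just 6
coxM _ = nothing

module _ {N : ℕ} (A : Matrix N) where

  pair : Fin N → Lat N → ℤ
  pair i μ = ∑ (λ j → A i j * μ j)

  sref : Fin N → Lat N → Lat N
  sref i μ t = μ t - pair i μ * e i t

  act : List (Fin N) → Lat N → Lat N
  act [] μ = μ
  act (i ∷ u) μ = sref i (act u μ)

  -- The affine Weyl group W_af by its Coxeter presentation:
  -- elements are words in the generators s_i, modulo the congruence
  -- generated by the relators s_i s_i and (s_i s_j)^{m_ij}.

  data Relator : List (Fin N) → Set where
    square : ∀ i → Relator (i ∷ i ∷ [])
    braid  : ∀ i j m → ¬ (i ≡ j) → coxM (A i j * A j i) ≡ just m →
             Relator (rep m (i ∷ j ∷ []))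

  data _≃_ : List (Fin N) → List (Fin N) → Set where
    del   : ∀ u r v → Relator r → (u ++ r ++ v) ≃ (u ++ v)
    ≃refl  : ∀ {u} → u ≃ u
    ≃sym   : ∀ {u v} → u ≃ v → v ≃ u
    ≃trans : ∀ {u v w} → u ≃ v → v ≃ w → u ≃ w

  IsLength : List (Fin N) → ℕ → Set
  IsLength v k = (Σ (List (Fin N)) λ u → (length u ≡ k) × (u ≃ v))
               × (∀ u → u ≃ v → k ℕ.≤ length u)

  IsGCM : Set
  IsGCM = (∀ i → A i i ≡ + 2)
        × (∀ i j → ¬ (i ≡ j) → A i j ≤ + 0)
        × (∀ i j → A i j ≡ + 0 → A j i ≡ + 0)

  Indecomposable : Set
  Indecomposable = (S : Fin N → Bool) → (Σ (Fin N) λ i → S i ≡ true) →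
    (Σ (Fin N) λ j → S j ≡ false) →
    Σ (Fin N) λ i → Σ (Fin N) λ j → (S i ≡ true) × (S j ≡ false) × ¬ (A i j ≡ + 0)

  Positive Negative : Lat N → Set
  Positive β = ∀ t → + 0 ≤ β t
  Negative β = ∀ t → β t ≤ + 0

  -- step from u a_0 to u s_i a_0 is forward iff ℓ(u) < ℓ(u s_i)
  Forward Backward : List (Fin N) → Fin N → Set
  Forward u i = ∀ a b → IsLength u a → IsLength (u ++ i ∷ []) b → a ℕ.< b
  Backward u i = ∀ a b → IsLength u a → IsLength (u ++ i ∷ []) b → b ℕ.< a

  ValidLabel : List (Fin N) → Fin N → Lat N → Set
  ValidLabel u i β =
      ((∀ t → β t ≡ act u (e i) t) ⊎ (∀ t → β t ≡ - act u (e i) t))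
    × (Forward u i → Positive β)
    × (Backward u i → Negative β)

  ValidLabels : (γ : List (Fin N)) → (Fin (length γ) → Lat N) → Set
  ValidLabels γ β = ∀ (j : Fin (length γ)) →
    ValidLabel (take (toℕ j) γ) (lookup γ j) (β j)

-- Affine Cartan datum with node 0 = zero, I_0 = suc-image

module _ {k : ℕ} (A : Matrix (suc k)) where

  -- roots of the finite root system R of (I_0, A_0): u α_j with u a word in
  -- the s_i, i ∈ I_0, and j ∈ I_0
  FinRoot : Lat (suc k) → Set
  FinRoot β = Σ (List (Fin k)) λ u → Σ (Fin k) λ j →
    ∀ t → β t ≡ act A (map suc u) (e (suc j)) t

  HighestRoot : Lat (suc k) → Set
  HighestRoot θ = FinRoot θ × (∀ β → FinRoot β → ∀ t → β t ≤ θ t)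

  deltaOf : Lat (suc k) → Lat (suc k)
  deltaOf θ t = e zero t + θ t

  AffineCartan : Set
  AffineCartan = IsGCM A × Indecomposable A ×
    Σ (Lat (suc k)) λ θ → HighestRoot θ × (∀ i → pair A i (deltaOf θ) ≡ + 0)

allMasks : (m : ℕ) → List (Vec Bool m)
allMasks zero = [] ∷ []
allMasks (suc m) = map (false ∷_) (allMasks m) ++ map (true ∷_) (allMasks m)

support : ∀ {m} → Vec Bool m → ℕ
support [] = 0
support (true ∷ ε) = suc (support ε)
support (false ∷ ε) = support ε

-- w^ε as an expression: the subword of the type selected by ε
masked : ∀ {X : Set} (γ : List X) → Vec Bool (length γ) → List X
masked [] [] = []
masked (i ∷ γ) (true ∷ ε) = i ∷ masked γ ε
masked (i ∷ γ) (false ∷ ε) = masked γ ε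

-- a root lattice element read as a linear polynomial in α_0,…,α_{N-1},
-- evaluated at the integer point x
ev : ∀ {N} → Lat N → (Fin N → ℤ) → ℤ
ev β x = ∑ (λ t → β t * x t)

psiAt : ∀ {N} (γ : List (Fin N)) → (Fin (length γ) → Lat N) →
        (Fin N → ℤ) → Vec Bool (length γ) → ℤ
psiAt [] β x [] = + 1
psiAt (i ∷ γ) β x (true ∷ ε) = ev (β zero) x * psiAt γ (λ j → β (suc j)) x ε
psiAt (i ∷ γ) β x (false ∷ ε) = psiAt γ (λ j → β (suc j)) x ε

sumℤ : List ℤ → ℤ
sumℤ = foldr _+_ (+ 0)

-- Σ_{ε : |ε| = l, w^ε = v} Ψ^ε_γ, evaluated at x; membership in W_af is
-- decided with a decision procedure `dec` for equality in W_af
maskSum : ∀ {N} (A : Matrix N) → ((u v : List (Fin N)) → Dec (_≃_ A u v)) →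
  (γ : List (Fin N)) → (Fin (length γ) → Lat N) →
  List (Fin N) → ℕ → (Fin N → ℤ) → ℤ
maskSum A dec γ β v l x = sumℤ (map term (allMasks (length γ)))
  where
  term : Vec Bool (length γ) → ℤ
  term ε = if (support ε ≡ᵇ l) ∧ does (dec (masked γ ε) v)
           then psiAt γ β x ε else + 0

-- The labels are forced: ℓ(u s_i) > ℓ(u) implies u α_i > 0 (by induction on ℓ(u), writing u = v y with y
-- in a rank-two parabolic subgroup and ℓ(v) minimal), and u α_i ≠ 0, so the sign conditions leave only
-- β = u α_i for the step from u to u s_i. With these labels the mask sum depends on the type alone, and it
-- does not change when a relator r is inserted or deleted: tested against any function of the selected
-- subword that depends only on its class and length and vanishes on non-reduced words, the masks of r,
-- weighted by Ψ, sum to the value at the empty word. For s_i s_i the two one-letter masks carry opposite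
-- labels; for a braid relator it is a polynomial identity in the values of P α_i and P α_j, checked for
-- each finite rank-two type.

module Submission where

open import Defs
open import Data.Nat as ℕ using (ℕ; zero; suc; _≤_; _<_; _∸_; _≡ᵇ_; z≤n; s≤s; parity)
import Data.Nat.Properties as ℕₚ
open import Data.Nat.Induction using (<-wellFounded)
open import Induction.WellFounded using (Acc; acc)
open import Data.Parity using (0ℙ; _⁻¹) renaming (_+_ to _ℙ+_)
import Data.Parity.Properties as ℙₚ
open import Data.Integer using (ℤ; +_; -[1+_]; _+_; _*_; _-_; -_; _⊖_; +≤+)
import Data.Integer as ℤ
import Data.Integer.Properties as ℤₚ
open import Data.Integer.Tactic.RingSolver using (solve-∀)
open import Algebra.Properties.CommutativeSemigroup ℤₚ.+-commutativeSemigroup using (interchange)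
open import Data.Fin using (Fin; zero; suc; toℕ)
import Data.Fin.Properties as Finₚ
open import Data.List using (List; []; _∷_; _++_; _∷ʳ_; length; map; reverse; take; lookup; initLast; _∷ʳ′_)
open import Data.List.Properties
  using (++-assoc; length-++; ++-identityʳ; map-++; length-map; unfold-reverse; reverse-map; ≡-dec; ∷-injectiveˡ)
open import Data.Vec using (Vec; []; _∷_)
open import Data.Bool using (Bool; true; false; not; if_then_else_; _∧_)
import Data.Bool as Bool
open import Data.Bool.Properties using (not-involutive; not-injective; ¬-not) renaming (_≟_ to _≟ᴮ_)
open import Data.Maybe using (just; nothing)
open import Data.Product using (Σ; ∃; ∃₂; _×_; _,_; proj₁; proj₂)
open import Data.Sum using (_⊎_; inj₁; inj₂; map₂; [_,_])
open import Data.Empty using (⊥; ⊥-elim)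
open import Function using (_∘_; _∘′_)
open import Relation.Nullary using (¬_; Dec; yes; no; does; contradiction)
open import Relation.Nullary.Decidable using (_×-dec_; from-yes; dec-true; dec-false)
open import Relation.Binary.Definitions using (DecidableEquality; tri<; tri≈; tri>)
open import Relation.Binary.PropositionalEquality
  using (_≡_; _≢_; _≗_; refl; sym; trans; cong; cong₂; subst; subst₂; module ≡-Reasoning)

-- Sums over Fin and the action on the root lattice

∑-cong : ∀ {m} {f g : Fin m → ℤ} → f ≗ g → ∑ f ≡ ∑ g
∑-cong {zero}  f≗g = refl
∑-cong {suc m} f≗g = cong₂ _+_ (f≗g zero) (∑-cong (f≗g ∘ suc))

∑-distrib-+ : ∀ {m} (f g : Fin m → ℤ) → ∑ (λ t → f t + g t) ≡ ∑ f + ∑ g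
∑-distrib-+ {zero}  f g = refl
∑-distrib-+ {suc m} f g =
  trans (cong (_+_ (f zero + g zero)) (∑-distrib-+ (f ∘ suc) (g ∘ suc)))
        (interchange (f zero) (g zero) (∑ (f ∘ suc)) (∑ (g ∘ suc)))

*-distribˡ-∑ : ∀ {m} c (f : Fin m → ℤ) → c * ∑ f ≡ ∑ (λ t → c * f t)
*-distribˡ-∑ {zero}  c f = ℤₚ.*-zeroʳ c
*-distribˡ-∑ {suc m} c f =
  trans (ℤₚ.*-distribˡ-+ c (f zero) _) (cong (_+_ (c * f zero)) (*-distribˡ-∑ c (f ∘ suc)))

∑-zero : ∀ m → ∑ {m} (λ _ → + 0) ≡ + 0
∑-zero zero    = refl
∑-zero (suc m) = trans (ℤₚ.+-identityˡ _) (∑-zero m)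

∑-linComb : ∀ {m} {f g h : Fin m → ℤ} c d → (∀ t → f t ≡ c * g t + d * h t) →
            ∑ f ≡ c * ∑ g + d * ∑ h
∑-linComb {f = f} {g} {h} c d f≗ = begin
  ∑ f                                           ≡⟨ ∑-cong f≗ ⟩
  ∑ (λ t → c * g t + d * h t)                   ≡⟨ ∑-distrib-+ (λ t → c * g t) (λ t → d * h t) ⟩
  ∑ (λ t → c * g t) + ∑ (λ t → d * h t)         ≡⟨ sym (cong₂ _+_ (*-distribˡ-∑ c g) (*-distribˡ-∑ d h)) ⟩
  c * ∑ g + d * ∑ h                             ∎
  where open ≡-Reasoning

e-diag : ∀ {N} (i : Fin N) → e i i ≡ + 1
e-diag zero    = refl
e-diag (suc i) = e-diag i

e-nonneg : ∀ {N} (i : Fin N) t → + 0 ℤ.≤ e i t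
e-nonneg zero    zero    = +≤+ z≤n
e-nonneg zero    (suc t) = +≤+ z≤n
e-nonneg (suc i) zero    = +≤+ z≤n
e-nonneg (suc i) (suc t) = e-nonneg i t

∑-*-e : ∀ {m} (f : Fin m → ℤ) i → ∑ (λ t → f t * e i t) ≡ f i
∑-*-e {suc m} f zero = begin
  f zero * + 1 + ∑ (λ t → f (suc t) * + 0)   ≡⟨ cong₂ _+_ (ℤₚ.*-identityʳ (f zero)) (∑-cong (ℤₚ.*-zeroʳ ∘ f ∘ suc)) ⟩
  f zero + ∑ {m} (λ _ → + 0)                 ≡⟨ cong (_+_ (f zero)) (∑-zero m) ⟩
  f zero + + 0                               ≡⟨ ℤₚ.+-identityʳ _ ⟩
  f zero                                     ∎
  where open ≡-Reasoning
∑-*-e {suc m} f (suc i) =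
  trans (cong₂ _+_ (ℤₚ.*-zeroʳ (f zero)) (∑-*-e (f ∘ suc) i)) (ℤₚ.+-identityˡ _)

linComb : ∀ {N} → ℤ → Lat N → ℤ → Lat N → Lat N
linComb c μ d ν t = c * μ t + d * ν t

ev-cong : ∀ {N} {μ ν : Lat N} → μ ≗ ν → ∀ x → ev μ x ≡ ev ν x
ev-cong μ≗ν x = ∑-cong (λ t → cong (_* x t) (μ≗ν t))

ev-linComb : ∀ {N} c (μ : Lat N) d ν x → ev (linComb c μ d ν) x ≡ c * ev μ x + d * ev ν x
ev-linComb c μ d ν x = ∑-linComb c d (λ t → distrib c (μ t) d (ν t) (x t))
  where
  distrib : ∀ c m d n y → (c * m + d * n) * y ≡ c * (m * y) + d * (n * y)
  distrib = solve-∀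

ev-neg : ∀ {N} (μ : Lat N) x → ev (λ t → - μ t) x ≡ - ev μ x
ev-neg μ x = trans (ev-cong (λ t → sym (negate (μ t))) x) (trans (ev-linComb (- + 1) μ (+ 0) μ x) (negate (ev μ x)))
  where
  negate : ∀ a → - + 1 * a + + 0 * a ≡ - a
  negate = solve-∀

module Action {N : ℕ} (A : Matrix N) where

  pair-cong : ∀ i {μ ν : Lat N} → μ ≗ ν → pair A i μ ≡ pair A i ν
  pair-cong i μ≗ν = ∑-cong (λ t → cong (A i t *_) (μ≗ν t))

  pair-linComb : ∀ i c μ d ν → pair A i (linComb c μ d ν) ≡ c * pair A i μ + d * pair A i ν
  pair-linComb i c μ d ν = ∑-linComb c d (λ t → distrib (A i t) c (μ t) d (ν t))
    where
    distrib : ∀ a c m d n → a * (c * m + d * n) ≡ c * (a * m) + d * (a * n)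
    distrib = solve-∀

  pair-e : ∀ i j → pair A i (e j) ≡ A i j
  pair-e i j = ∑-*-e (A i) j

  sref-cong : ∀ i {μ ν : Lat N} → μ ≗ ν → sref A i μ ≗ sref A i ν
  sref-cong i μ≗ν t = cong₂ (λ a b → a - b * e i t) (μ≗ν t) (pair-cong i μ≗ν)

  act-cong : ∀ u {μ ν : Lat N} → μ ≗ ν → act A u μ ≗ act A u ν
  act-cong []      μ≗ν = μ≗ν
  act-cong (i ∷ u) μ≗ν = sref-cong i (act-cong u μ≗ν)

  act-++ : ∀ u v (μ : Lat N) → act A (u ++ v) μ ≗ act A u (act A v μ)
  act-++ []      v μ t = refl
  act-++ (i ∷ u) v μ   = sref-cong i (act-++ u v μ)

  sref-linComb : ∀ i c μ d ν → sref A i (linComb c μ d ν) ≗ linComb c (sref A i μ) d (sref A i ν)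
  sref-linComb i c μ d ν t =
    trans (cong (λ a → linComb c μ d ν t - a * e i t) (pair-linComb i c μ d ν))
          (distrib c (μ t) d (ν t) _ _ (e i t))
    where
    distrib : ∀ c m d n a b ε → c * m + d * n - (c * a + d * b) * ε ≡ c * (m - a * ε) + d * (n - b * ε)
    distrib = solve-∀

  act-linComb : ∀ u c μ d ν → act A u (linComb c μ d ν) ≗ linComb c (act A u μ) d (act A u ν)
  act-linComb []      c μ d ν t = refl
  act-linComb (i ∷ u) c μ d ν t =
    trans (sref-cong i (act-linComb u c μ d ν) t) (sref-linComb i c _ d _ t)

  act-zero : ∀ u → act A u (λ _ → + 0) ≗ (λ _ → + 0)
  act-zero u t = begin
    act A u 0ᴸ t                           ≡⟨ act-cong u (λ _ → refl) t ⟩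
    act A u (linComb (+ 0) 0ᴸ (+ 0) 0ᴸ) t  ≡⟨ act-linComb u (+ 0) 0ᴸ (+ 0) 0ᴸ t ⟩
    + 0 * act A u 0ᴸ t + + 0 * act A u 0ᴸ t ≡⟨ cong₂ _+_ (ℤₚ.*-zeroˡ (act A u 0ᴸ t)) (ℤₚ.*-zeroˡ (act A u 0ᴸ t)) ⟩
    + 0                                    ∎
    where
    open ≡-Reasoning
    0ᴸ : Lat N
    0ᴸ _ = + 0

  module _ (diag : ∀ i → A i i ≡ + 2) where

    sref-self : ∀ i → sref A i (e i) ≗ linComb (- + 1) (e i) (+ 0) (e i)
    sref-self i t = trans (cong (λ a → e i t - a * e i t) (trans (pair-e i i) (diag i))) (negate (e i t))
      where
      negate : ∀ a → a - + 2 * a ≡ - + 1 * a + + 0 * a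
      negate = solve-∀

    sref-invol : ∀ i (μ : Lat N) → sref A i (sref A i μ) ≗ μ
    sref-invol i μ t = begin
      sref A i (sref A i μ) t                      ≡⟨ cong (λ b → sref A i μ t - b * e i t) pair-sref ⟩
      μ t - a * e i t - (+ 1 * a + - a * + 2) * e i t ≡⟨ cancel (μ t) a (e i t) ⟩
      μ t                                          ∎
      where
      open ≡-Reasoning
      a = pair A i μ
      cancel : ∀ m a ε → m - a * ε - (+ 1 * a + - a * + 2) * ε ≡ m
      cancel = solve-∀
      pair-sref : pair A i (sref A i μ) ≡ + 1 * a + - a * + 2
      pair-sref = begin
        pair A i (sref A i μ)               ≡⟨ pair-cong i (λ s → minus (μ s) a (e i s)) ⟩
        pair A i (linComb (+ 1) μ (- a) (e i)) ≡⟨ pair-linComb i (+ 1) μ (- a) (e i) ⟩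
        + 1 * a + - a * pair A i (e i)      ≡⟨ cong (λ c → + 1 * a + - a * c) (trans (pair-e i i) (diag i)) ⟩
        + 1 * a + - a * + 2                 ∎
        where
        minus : ∀ m a ε → m - a * ε ≡ + 1 * m + - a * ε
        minus = solve-∀

    act-∷ʳ-self : ∀ u i → act A (u ∷ʳ i) (e i) ≗ (λ t → - act A u (e i) t)
    act-∷ʳ-self u i t = begin
      act A (u ∷ʳ i) (e i) t                                  ≡⟨ act-++ u (i ∷ []) (e i) t ⟩
      act A u (sref A i (e i)) t                              ≡⟨ act-cong u (sref-self i) t ⟩
      act A u (linComb (- + 1) (e i) (+ 0) (e i)) t           ≡⟨ act-linComb u (- + 1) (e i) (+ 0) (e i) t ⟩
      - + 1 * act A u (e i) t + + 0 * act A u (e i) t         ≡⟨ negate (act A u (e i) t) ⟩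
      - act A u (e i) t                                       ∎
      where
      open ≡-Reasoning
      negate : ∀ a → - + 1 * a + + 0 * a ≡ - a
      negate = solve-∀

    act-reverse : ∀ u μ → act A (reverse u) (act A u μ) ≗ μ
    act-reverse []      μ t = refl
    act-reverse (i ∷ u) μ t = begin
      act A (reverse (i ∷ u)) (act A (i ∷ u) μ) t     ≡⟨ cong (λ w → act A w (act A (i ∷ u) μ) t) (unfold-reverse i u) ⟩
      act A (reverse u ∷ʳ i) (act A (i ∷ u) μ) t      ≡⟨ act-++ (reverse u) (i ∷ []) _ t ⟩
      act A (reverse u) (sref A i (sref A i (act A u μ))) t ≡⟨ act-cong (reverse u) (sref-invol i _) t ⟩
      act A (reverse u) (act A u μ) t                 ≡⟨ act-reverse u μ t ⟩
      μ t                                             ∎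
      where open ≡-Reasoning

    act-e-nonzero : ∀ u i → ¬ (∀ t → act A u (e i) t ≡ + 0)
    act-e-nonzero u i zero-vector with
      trans (sym (e-diag i)) (trans (sym (act-reverse u (e i) i))
        (trans (act-cong (reverse u) zero-vector i) (act-zero (reverse u) i)))
    ... | ()

-- Words modulo the Coxeter relations

any?-Bool : {P : Bool → Set} → (∀ b → Dec (P b)) → Dec (∃ P)
any?-Bool P? with P? true | P? false
... | yes p  | _      = yes (true , p)
... | no _   | yes p  = yes (false , p)
... | no ¬pt | no ¬pf = no λ { (true , p) → ¬pt p ; (false , p) → ¬pf p }

module _ {X : Set} (any? : {P : X → Set} → (∀ x → Dec (P x)) → Dec (∃ P)) where

  ∃-ofLength? : {P : List X → Set} → (∀ z → Dec (P z)) → ∀ n → Dec (∃ λ z → length z ≡ n × P z)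
  ∃-ofLength? P? zero with P? []
  ... | yes p = yes ([] , refl , p)
  ... | no ¬p = no λ { ([] , _ , p) → ¬p p }
  ∃-ofLength? P? (suc n) with any? (λ a → ∃-ofLength? (λ z → P? (a ∷ z)) n)
  ... | yes (a , z , refl , p) = yes (a ∷ z , refl , p)
  ... | no ¬q = no λ { (a ∷ z , refl , p) → ¬q (a , z , refl , p) }

minimal : {P : ℕ → Set} → (∀ n → Dec (P n)) → ∀ {n} → P n → ∃ λ m → P m × (∀ k → P k → m ≤ k)
minimal {P} P? {n} = go n (<-wellFounded n)
  where
  go : ∀ n → Acc _<_ n → P n → ∃ λ m → P m × (∀ k → P k → m ≤ k)
  go n (acc smaller) pn with ℕₚ.anyUpTo? P? n
  ... | yes (k , k<n , pk) = go k (smaller k<n) pk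
  ... | no ¬below = n , pn , λ k pk → ℕₚ.≮⇒≥ (λ k<n → ¬below (k , k<n , pk))

length-∷ʳ : ∀ {X : Set} (u : List X) a → length (u ∷ʳ a) ≡ suc (length u)
length-∷ʳ u a = trans (length-++ u) (ℕₚ.+-comm (length u) 1)

length-infix-< : ∀ {X : Set} (u w : List X) {z z′ : List X} → length z′ < length z →
                 length (u ++ z′ ++ w) < length (u ++ z ++ w)
length-infix-< u w {z} {z′} lt
  rewrite length-++ u {z′ ++ w} | length-++ u {z ++ w} | length-++ z′ {w} | length-++ z {w} =
  ℕₚ.+-monoʳ-< (length u) (ℕₚ.+-monoˡ-< (length w) lt)

module Words {N : ℕ} (A : Matrix N) where

  Word : Set
  Word = List (Fin N)

  infix 4 _≈_
  _≈_ : Word → Word → Set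
  _≈_ = _≃_ A

  ≈-congˡ : ∀ u {z z′} → z ≈ z′ → u ++ z ≈ u ++ z′
  ≈-congˡ u (del u′ r v′ R) =
    subst₂ _≈_ (++-assoc u u′ (r ++ v′)) (++-assoc u u′ v′) (del (u ++ u′) r v′ R)
  ≈-congˡ u ≃refl          = ≃refl
  ≈-congˡ u (≃sym p)       = ≃sym (≈-congˡ u p)
  ≈-congˡ u (≃trans p q)   = ≃trans (≈-congˡ u p) (≈-congˡ u q)

  ≈-congʳ : ∀ w {z z′} → z ≈ z′ → z ++ w ≈ z′ ++ w
  ≈-congʳ w (del u′ r v′ R) =
    subst₂ _≈_ (sym (trans (++-assoc u′ (r ++ v′) w) (cong (u′ ++_) (++-assoc r v′ w))))
               (sym (++-assoc u′ v′ w)) (del u′ r (v′ ++ w) R)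
  ≈-congʳ w ≃refl        = ≃refl
  ≈-congʳ w (≃sym p)     = ≃sym (≈-congʳ w p)
  ≈-congʳ w (≃trans p q) = ≃trans (≈-congʳ w p) (≈-congʳ w q)

  ≈-cong : ∀ u w {z z′} → z ≈ z′ → u ++ z ++ w ≈ u ++ z′ ++ w
  ≈-cong u w p = ≈-congˡ u (≈-congʳ w p)

  cancel-square : ∀ u i w → u ++ i ∷ i ∷ w ≈ u ++ w
  cancel-square u i w = del u (i ∷ i ∷ []) w (square i)

  cancel-∷ʳ-∷ʳ : ∀ u i → u ∷ʳ i ∷ʳ i ≈ u
  cancel-∷ʳ-∷ʳ u i = subst₂ _≈_ (sym (++-assoc u (i ∷ []) (i ∷ []))) (++-identityʳ u) (cancel-square u i [])

  Relator-even : ∀ {r} → Relator A r → parity (length r) ≡ 0ℙ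
  Relator-even (square i)        = refl
  Relator-even (braid i j m _ _) = rep-even m
    where
    rep-even : ∀ m → parity (length (rep m (i ∷ j ∷ []))) ≡ 0ℙ
    rep-even zero    = refl
    rep-even (suc m) = rep-even m

  ≈-parity : ∀ {u v} → u ≈ v → parity (length u) ≡ parity (length v)
  ≈-parity (del u r v R) = begin
    parity (length (u ++ r ++ v))                           ≡⟨ cong parity (length-++ u) ⟩
    parity (length u ℕ.+ length (r ++ v))                   ≡⟨ cong (λ n → parity (length u ℕ.+ n)) (length-++ r) ⟩
    parity (length u ℕ.+ (length r ℕ.+ length v))           ≡⟨ ℙₚ.+-homo-+ (length u) _ ⟩
    parity (length u) ℙ+ parity (length r ℕ.+ length v)     ≡⟨ cong (parity (length u) ℙ+_) (ℙₚ.+-homo-+ (length r) _) ⟩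
    parity (length u) ℙ+ (parity (length r) ℙ+ parity (length v))
      ≡⟨ cong (λ p → parity (length u) ℙ+ (p ℙ+ parity (length v))) (Relator-even R) ⟩
    parity (length u) ℙ+ parity (length v)                  ≡⟨ sym (ℙₚ.+-homo-+ (length u) _) ⟩
    parity (length u ℕ.+ length v)                          ≡⟨ cong parity (sym (length-++ u)) ⟩
    parity (length (u ++ v))                                ∎
    where
    open ≡-Reasoning
  ≈-parity ≃refl        = refl
  ≈-parity (≃sym p)     = sym (≈-parity p)
  ≈-parity (≃trans p q) = trans (≈-parity p) (≈-parity q)

  Reducible : Word → Set
  Reducible z = ∃ λ z′ → z ≈ z′ × length z′ < length z

  Reducible-infix : ∀ u w {z} → Reducible z → Reducible (u ++ z ++ w)
  Reducible-infix u w (z′ , z≈z′ , shorter) = u ++ z′ ++ w , ≈-cong u w z≈z′ , length-infix-< u w shorter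

  IsLength-≈ : ∀ {u v l} → u ≈ v → IsLength A u l → IsLength A v l
  IsLength-≈ u≈v ((z , lz , z≈u) , l-min) =
    (z , lz , ≃trans z≈u u≈v) , λ z′ z′≈v → l-min z′ (≃trans z′≈v (≃sym u≈v))

  IsLength-unique : ∀ {u a b} → IsLength A u a → IsLength A u b → a ≡ b
  IsLength-unique ((z , refl , z≈u) , a-min) ((z′ , refl , z′≈u) , b-min) =
    ℕₚ.≤-antisym (a-min z′ z′≈u) (b-min z z≈u)

  IsLength-no-shorter : ∀ {u l z} → IsLength A u l → z ≈ u → length z < l → ⊥
  IsLength-no-shorter (_ , l-min) z≈u shorter = ℕₚ.<⇒≱ shorter (l-min _ z≈u)

  IsLength-∷ʳ : ∀ {u i a b} → IsLength A u a → IsLength A (u ∷ʳ i) b → b ≡ suc a ⊎ a ≡ suc b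
  IsLength-∷ʳ {u} {i} {a} {b} ((z , refl , z≈u) , a-min) ((z′ , refl , z′≈ui) , b-min)
    with ℕₚ.<-cmp a b
  ... | tri< a<b _ _ = inj₁ (ℕₚ.≤-antisym b≤1+a a<b)
    where
    b≤1+a : b ≤ suc a
    b≤1+a = subst (b ≤_) (length-∷ʳ z i) (b-min (z ∷ʳ i) (≈-congʳ (i ∷ []) z≈u))
  ... | tri> _ _ b<a = inj₂ (ℕₚ.≤-antisym a≤1+b b<a)
    where
    a≤1+b : a ≤ suc b
    a≤1+b = subst (a ≤_) (length-∷ʳ z′ i) (a-min (z′ ∷ʳ i) (≃trans (≈-congʳ (i ∷ []) z′≈ui) (cancel-∷ʳ-∷ʳ u i)))
  ... | tri≈ _ a≡b _ = ⊥-elim (ℙₚ.p≢p⁻¹ (parity (length u)) parities)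
    where
    parities : parity (length u) ≡ parity (length u) ⁻¹
    parities = begin
      parity (length u)         ≡⟨ sym (≈-parity z≈u) ⟩
      parity (length z)         ≡⟨ cong parity a≡b ⟩
      parity (length z′)        ≡⟨ ≈-parity z′≈ui ⟩
      parity (length (u ∷ʳ i))  ≡⟨ cong parity (length-∷ʳ u i) ⟩
      parity (suc (length u))   ≡⟨ sym (ℙₚ.suc-homo-⁻¹ (suc (length u))) ⟩
      parity (length u) ⁻¹      ∎
      where open ≡-Reasoning

  module _ (dec : ∀ u v → Dec (u ≈ v)) where

    ∃-IsLength : ∀ u → ∃ (IsLength A u)
    ∃-IsLength u with minimal (∃-ofLength? Finₚ.any? (λ z → dec z u)) (u , refl , ≃refl)
    ... | l , (z , lz , z≈u) , l-min = l , (z , lz , z≈u) , λ z′ z′≈u → l-min (length z′) (z′ , refl , z′≈u)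

-- Words in two generators

flips : Bool → ℕ → Bool
flips b zero    = b
flips b (suc k) = not (flips b k)

-- alternating b k is the alternating word of length k whose last letter is b.
alternating : Bool → ℕ → List Bool
alternating b zero    = []
alternating b (suc k) = flips b k ∷ alternating b k

flips-not : ∀ b k → flips (not b) k ≡ not (flips b k)
flips-not b zero    = refl
flips-not b (suc k) = cong not (flips-not b k)

flips-+ : ∀ b n k → flips b (n ℕ.+ k) ≡ flips (flips b k) n
flips-+ b zero    k = refl
flips-+ b (suc n) k = cong not (flips-+ b n k)

flips-even : ∀ b k → flips b (k ℕ.+ k) ≡ b
flips-even b zero    = refl
flips-even b (suc k) rewrite ℕₚ.+-suc k k = trans (not-involutive _) (flips-even b k)

length-alternating : ∀ b k → length (alternating b k) ≡ k
length-alternating b zero    = refl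
length-alternating b (suc k) = cong suc (length-alternating b k)

alternating-∷ʳ : ∀ b k → alternating b (suc k) ≡ alternating (not b) k ∷ʳ b
alternating-∷ʳ b zero    = refl
alternating-∷ʳ b (suc k) = cong₂ _∷_ (sym (flips-not b k)) (alternating-∷ʳ b k)

alternating-+ : ∀ b n k → alternating b (n ℕ.+ k) ≡ alternating (flips b k) n ++ alternating b k
alternating-+ b zero    k = refl
alternating-+ b (suc n) k = cong₂ _∷_ (flips-+ b n k) (alternating-+ b n k)

braidWord : ℕ → List Bool
braidWord m = rep m (true ∷ false ∷ [])

braidWord-alternating : ∀ m → braidWord m ≡ alternating false (m ℕ.+ m)
braidWord-alternating zero    = refl
braidWord-alternating (suc m) rewrite ℕₚ.+-suc m m =
  cong₂ _∷_ (sym (cong not (flips-even false m))) (cong₂ _∷_ (sym (flips-even false m)) (braidWord-alternating m))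

reverse-alternating : ∀ b k → reverse (alternating b (suc k)) ≡ alternating (flips b k) (suc k)
reverse-alternating b zero    = refl
reverse-alternating b (suc k) = begin
  reverse (alternating b (suc (suc k)))
    ≡⟨ unfold-reverse (flips b (suc k)) (alternating b (suc k)) ⟩
  reverse (alternating b (suc k)) ∷ʳ flips b (suc k)
    ≡⟨ cong (_∷ʳ flips b (suc k)) (reverse-alternating b k) ⟩
  alternating (flips b k) (suc k) ∷ʳ flips b (suc k)
    ≡⟨ cong (λ c → alternating c (suc k) ∷ʳ flips b (suc k)) (sym (not-involutive (flips b k))) ⟩
  alternating (not (flips b (suc k))) (suc k) ∷ʳ flips b (suc k)
    ≡⟨ sym (alternating-∷ʳ (flips b (suc k)) (suc k)) ⟩
  alternating (flips b (suc k)) (suc (suc k)) ∎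
  where open ≡-Reasoning

HasSquare : List Bool → Set
HasSquare y = Σ (List Bool) λ a → Σ Bool λ b → Σ (List Bool) λ c → y ≡ a ++ b ∷ b ∷ c

square-or-alternating : ∀ y → HasSquare y ⊎ ∃ λ b → y ≡ alternating b (length y)
square-or-alternating [] = inj₂ (true , refl)
square-or-alternating (c ∷ y) with square-or-alternating y
... | inj₁ (a , b , d , refl) = inj₁ (c ∷ a , b , d , refl)
... | inj₂ (b , y≡alt) with length y | y≡alt
...   | zero  | refl = inj₂ (c , refl)
...   | suc k | refl with c ≟ᴮ flips b k
...     | yes refl = inj₁ ([] , c , alternating b k , refl)
...     | no c≢    = inj₂ (b , cong (_∷ alternating b (suc k)) (¬-not c≢))

module Dihedral {N : ℕ} (A : Matrix N) (i j : Fin N) where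

  open Words A

  letter : Bool → Fin N
  letter true  = i
  letter false = j

  Letters : List Bool → Word
  Letters = map letter

  length-Letters-alternating : ∀ c k → length (Letters (alternating c k)) ≡ k
  length-Letters-alternating c k = trans (length-map letter (alternating c k)) (length-alternating c k)

  Letters-braidWord : ∀ n → Letters (braidWord n) ≡ rep n (i ∷ j ∷ [])
  Letters-braidWord zero    = refl
  Letters-braidWord (suc n) = cong (λ z → i ∷ j ∷ z) (Letters-braidWord n)

  ++-reverse-≈-[] : ∀ (u : Word) → u ++ reverse u ≈ []
  ++-reverse-≈-[] []      = ≃refl
  ++-reverse-≈-[] (a ∷ u) =
    ≃trans (subst (_≈ a ∷ a ∷ []) (cong (a ∷_) regroup) (≈-cong (a ∷ []) (a ∷ []) (++-reverse-≈-[] u)))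
           (cancel-square [] a [])
    where
    regroup : (u ++ reverse u) ++ a ∷ [] ≡ u ++ reverse (a ∷ u)
    regroup = trans (++-assoc u (reverse u) (a ∷ [])) (sym (cong (u ++_) (unfold-reverse a u)))

  Reducible-square : ∀ y → HasSquare y → Reducible (Letters y)
  Reducible-square y (a , b , c , refl) rewrite map-++ letter a (b ∷ b ∷ c) =
    Reducible-infix (Letters a) (Letters c) (([] , cancel-square [] (letter b) [] , ℕ.s≤s ℕ.z≤n))

  module Braid (m′ : ℕ) (R : Relator A (rep (suc m′) (i ∷ j ∷ []))) where

    m : ℕ
    m = suc m′

    -- The relator is the product of two alternating words of length m; the first is the inverse of the second.
    braid-base : Letters (alternating (not (flips false m′)) m) ≈ Letters (alternating (flips false m′) m)
    braid-base = subst₂ _≈_ refl X≡reverse-Y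
      (≃trans (subst₂ _≈_ (++-identityʳ X) refl (≈-congˡ X (≃sym (++-reverse-≈-[] Y))))
              (subst₂ _≈_ (++-assoc X Y (reverse Y)) refl (≈-congʳ (reverse Y) X++Y≈[])))
      where
      X Y : Word
      X = Letters (alternating (flips false m) m)
      Y = Letters (alternating false m)
      X≡reverse-Y : reverse Y ≡ Letters (alternating (flips false m′) m)
      X≡reverse-Y = trans (sym (reverse-map letter (alternating false m))) (cong Letters (reverse-alternating false m′))
      X++Y≡relator : X ++ Y ≡ rep m (i ∷ j ∷ [])
      X++Y≡relator = begin
        X ++ Y                                                   ≡⟨ sym (map-++ letter (alternating _ m) (alternating false m)) ⟩
        Letters (alternating (flips false m) m ++ alternating false m) ≡⟨ cong Letters (sym (alternating-+ false m m)) ⟩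
        Letters (alternating false (m ℕ.+ m))                    ≡⟨ cong Letters (sym (braidWord-alternating m)) ⟩
        Letters (braidWord m)                                    ≡⟨ Letters-braidWord m ⟩
        rep m (i ∷ j ∷ [])                                       ∎
        where open ≡-Reasoning
      X++Y≈[] : X ++ Y ≈ []
      X++Y≈[] = subst₂ _≈_ (++-identityʳ (X ++ Y)) refl (del [] (X ++ Y) [] (subst (Relator A) (sym X++Y≡relator) R))

    braid-alternating : ∀ c → Letters (alternating c m) ≈ Letters (alternating (not c) m)
    braid-alternating c with c ≟ᴮ flips false m′
    ... | yes refl = ≃sym braid-base
    ... | no c≢ rewrite ¬-not c≢ | not-involutive (flips false m′) = braid-base

    Reducible-alternating-suc : ∀ b → Reducible (Letters (alternating b (suc m)))
    Reducible-alternating-suc b = Letters (alternating (not b) m′) , ≃trans braided squared , shorter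
      where
      braided : Letters (alternating b (suc m)) ≈ letter (flips b m) ∷ Letters (alternating (not b) m)
      braided = ≈-congˡ (letter (flips b m) ∷ []) (braid-alternating b)
      squared : letter (flips b m) ∷ Letters (alternating (not b) m) ≈ Letters (alternating (not b) m′)
      squared = subst (λ c → letter (flips b m) ∷ letter c ∷ rest ≈ rest)
                      (sym (flips-not b m′)) (cancel-square [] (letter (flips b m)) rest)
        where rest = Letters (alternating (not b) m′)
      shorter : length (Letters (alternating (not b) m′)) < length (Letters (alternating b (suc m)))
      shorter = subst₂ _<_ (sym (length-Letters-alternating (not b) m′)) (sym (length-Letters-alternating b (suc m)))
                      (ℕₚ.<-trans (ℕₚ.n<1+n m′) (ℕₚ.n<1+n m))

    Reducible-alternating : ∀ b k → m < k → Reducible (Letters (alternating b k))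
    Reducible-alternating b k m<k =
      subst (λ n → Reducible (Letters (alternating b n))) (ℕₚ.m∸n+n≡m m<k) reducible
      where
      d = k ∸ suc m
      reducible : Reducible (Letters (alternating b (d ℕ.+ suc m)))
      reducible rewrite alternating-+ b d (suc m)
                      | map-++ letter (alternating (flips b (suc m)) d) (alternating b (suc m)) =
        subst Reducible (cong (Letters (alternating (flips b (suc m)) d) ++_) (++-identityʳ _))
              (Reducible-infix (Letters (alternating (flips b (suc m)) d)) [] (Reducible-alternating-suc b))

    alternating-≈-∷ʳ-i : ∀ K → m ≤ K → ∃ λ u → Letters (alternating false K) ≈ u ∷ʳ i × suc (length u) ≡ K
    alternating-≈-∷ʳ-i K m≤K =
      u , subst (λ n → Letters (alternating false n) ≈ u ∷ʳ i) (ℕₚ.m∸n+n≡m m≤K) braided , length-u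
      where
      d = K ∸ m
      P = Letters (alternating (flips false m) d)
      u = P ++ Letters (alternating false m′)
      braided : Letters (alternating false (d ℕ.+ m)) ≈ u ∷ʳ i
      braided = subst₂ _≈_ lhs rhs (≈-congˡ P (braid-alternating false))
        where
        lhs : P ++ Letters (alternating false m) ≡ Letters (alternating false (d ℕ.+ m))
        lhs = trans (sym (map-++ letter (alternating (flips false m) d) _)) (cong Letters (sym (alternating-+ false d m)))
        rhs : P ++ Letters (alternating true m) ≡ u ∷ʳ i
        rhs = trans (cong (λ z → P ++ Letters z) (alternating-∷ʳ true m′))
                    (trans (cong (P ++_) (map-++ letter (alternating false m′) (true ∷ [])))
                           (sym (++-assoc P _ (i ∷ []))))
      length-u : suc (length u) ≡ K
      length-u = begin
        suc (length u)                                           ≡⟨ cong suc (length-++ P) ⟩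
        suc (length P ℕ.+ length (Letters (alternating false m′)))
          ≡⟨ cong₂ (λ a b → suc (a ℕ.+ b)) (length-Letters-alternating _ d) (length-Letters-alternating false m′) ⟩
        suc (d ℕ.+ m′)                                           ≡⟨ sym (ℕₚ.+-suc d m′) ⟩
        d ℕ.+ m                                                  ≡⟨ ℕₚ.m∸n+n≡m m≤K ⟩
        K                                                        ∎
        where open ≡-Reasoning

-- Rank two

CartanPair : ℤ → ℤ → Set
CartanPair x y = x ℤ.≤ + 0 × y ℤ.≤ + 0 × (x ≡ + 0 → y ≡ + 0) × (y ≡ + 0 → x ≡ + 0)

cartanPair : ∀ {N} {A : Matrix N} → IsGCM A → ∀ {i j} → ¬ i ≡ j → CartanPair (A i j) (A j i)
cartanPair (_ , nonpos , sym0) i≢j = nonpos _ _ i≢j , nonpos _ _ (i≢j ∘′ sym) , sym0 _ _ , sym0 _ _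

data FiniteType : ℤ → ℤ → ℕ → Set where
  A₁×A₁ : FiniteType (+ 0) (+ 0) 2
  A₂    : FiniteType -[1+ 0 ] -[1+ 0 ] 3
  B₂    : FiniteType -[1+ 0 ] -[1+ 1 ] 4
  C₂    : FiniteType -[1+ 1 ] -[1+ 0 ] 4
  G₂    : FiniteType -[1+ 0 ] -[1+ 2 ] 6
  G₂′   : FiniteType -[1+ 2 ] -[1+ 0 ] 6

finiteType : ∀ {x y m} → CartanPair x y → coxM (x * y) ≡ just m → FiniteType x y m
finiteType {+ zero} (_ , _ , x≡0⇒y≡0 , _) eq rewrite x≡0⇒y≡0 refl with eq
... | refl = A₁×A₁
finiteType {+ suc _} (+≤+ () , _) _
finiteType { -[1+ _ ]} {+ zero} (_ , _ , _ , y≡0⇒x≡0) _ with y≡0⇒x≡0 refl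
... | ()
finiteType { -[1+ _ ]} {+ suc _} (_ , +≤+ () , _) _
finiteType { -[1+ 0 ]} { -[1+ 0 ]} _ refl = A₂
finiteType { -[1+ 0 ]} { -[1+ 1 ]} _ refl = B₂
finiteType { -[1+ 1 ]} { -[1+ 0 ]} _ refl = C₂
finiteType { -[1+ 0 ]} { -[1+ 2 ]} _ refl = G₂
finiteType { -[1+ 2 ]} { -[1+ 0 ]} _ refl = G₂′
finiteType { -[1+ 1 ]} { -[1+ 1 ]} _ ()
finiteType { -[1+ 1 ]} { -[1+ 2 ]} _ ()
finiteType { -[1+ 2 ]} { -[1+ 1 ]} _ ()
finiteType { -[1+ 2 ]} { -[1+ 2 ]} _ ()
finiteType { -[1+ 0 ]} { -[1+ suc (suc (suc _)) ]} _ ()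
finiteType { -[1+ 1 ]} { -[1+ suc (suc (suc _)) ]} _ ()
finiteType { -[1+ 2 ]} { -[1+ suc (suc (suc _)) ]} _ ()
finiteType { -[1+ suc (suc (suc _)) ]} { -[1+ 0 ]} _ ()
finiteType { -[1+ suc (suc (suc _)) ]} { -[1+ 1 ]} _ ()
finiteType { -[1+ suc (suc (suc _)) ]} { -[1+ 2 ]} _ ()
finiteType { -[1+ suc (suc (suc _)) ]} { -[1+ suc (suc (suc _)) ]} _ ()

FiniteType-order : ∀ {x y m} → FiniteType x y m → ∃ λ m′ → m ≡ suc m′
FiniteType-order A₁×A₁ = 1 , refl
FiniteType-order A₂    = 2 , refl
FiniteType-order B₂    = 3 , refl
FiniteType-order C₂    = 3 , refl
FiniteType-order G₂    = 5 , refl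
FiniteType-order G₂′   = 5 , refl

coxM-nothing : ∀ n → coxM (+ n) ≡ nothing → 4 ≤ n
coxM-nothing (suc (suc (suc (suc n)))) _ = s≤s (s≤s (s≤s (s≤s z≤n)))

infiniteType : ∀ {x y} → CartanPair x y → coxM (x * y) ≡ nothing →
               ∃₂ λ a b → x ≡ -[1+ a ] × y ≡ -[1+ b ] × 4 ≤ suc a ℕ.* suc b
infiniteType {+ zero} (_ , _ , x≡0⇒y≡0 , _) eq rewrite x≡0⇒y≡0 refl with eq
... | ()
infiniteType {+ suc _} (+≤+ () , _) _
infiniteType { -[1+ _ ]} {+ zero} (_ , _ , _ , y≡0⇒x≡0) _ with y≡0⇒x≡0 refl
... | ()
infiniteType { -[1+ _ ]} {+ suc _} (_ , +≤+ () , _) _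
infiniteType { -[1+ a ]} { -[1+ b ]} _ eq = a , b , refl , refl , coxM-nothing (suc a ℕ.* suc b) eq

ℤ² : Set
ℤ² = ℤ × ℤ

-- (c , d) are the coordinates of μ + c α_i + d α_j, where a = ⟨α_i^∨, μ⟩, b = ⟨α_j^∨, μ⟩,
-- x = a_ij, y = a_ji; true stands for s_i and false for s_j.
reflect₂ : (x y a b : ℤ) → Bool → ℤ² → ℤ²
reflect₂ x y a b true  (c , d) = (- c - a - x * d , d)
reflect₂ x y a b false (c , d) = (c , - d - b - y * c)

act₂ : (x y a b : ℤ) → List Bool → ℤ² → ℤ²
act₂ x y a b []       v = v
act₂ x y a b (s ∷ bs) v = reflect₂ x y a b s (act₂ x y a b bs v)

act₂-++ : ∀ x y a b u w v → act₂ x y a b (u ++ w) v ≡ act₂ x y a b u (act₂ x y a b w v)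
act₂-++ x y a b []      w v = refl
act₂-++ x y a b (s ∷ u) w v = cong (reflect₂ x y a b s) (act₂-++ x y a b u w v)

unit₂ : Bool → ℤ²
unit₂ true  = (+ 1 , + 0)
unit₂ false = (+ 0 , + 1)

-- act₂ with coordinates that are linear forms in a and b, so that a braid relation is checked once for all μ.
LinearForms : Set
LinearForms = ℤ² × ℤ²

evalForms : ℤ → ℤ → LinearForms → ℤ²
evalForms a b ((c₁ , c₂) , (d₁ , d₂)) = (c₁ * a + c₂ * b , d₁ * a + d₂ * b)

reflectForms : (x y : ℤ) → Bool → LinearForms → LinearForms
reflectForms x y true  ((c₁ , c₂) , (d₁ , d₂)) = ((- c₁ - + 1 - x * d₁ , - c₂ - + 0 - x * d₂) , (d₁ , d₂))
reflectForms x y false ((c₁ , c₂) , (d₁ , d₂)) = ((c₁ , c₂) , (- d₁ - + 0 - y * c₁ , - d₂ - + 1 - y * c₂))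

actForms : (x y : ℤ) → List Bool → LinearForms → LinearForms
actForms x y []       v = v
actForms x y (s ∷ bs) v = reflectForms x y s (actForms x y bs v)

evalForms-reflect : ∀ x y a b s v → evalForms a b (reflectForms x y s v) ≡ reflect₂ x y a b s (evalForms a b v)
evalForms-reflect x y a b true ((c₁ , c₂) , (d₁ , d₂)) = cong (_, _) (distrib x a b c₁ c₂ d₁ d₂)
  where
  distrib : ∀ x a b c₁ c₂ d₁ d₂ → (- c₁ - + 1 - x * d₁) * a + (- c₂ - + 0 - x * d₂) * b
                                  ≡ - (c₁ * a + c₂ * b) - a - x * (d₁ * a + d₂ * b)
  distrib = solve-∀
evalForms-reflect x y a b false ((c₁ , c₂) , (d₁ , d₂)) = cong (_ ,_) (distrib y a b c₁ c₂ d₁ d₂)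
  where
  distrib : ∀ y a b c₁ c₂ d₁ d₂ → (- d₁ - + 0 - y * c₁) * a + (- d₂ - + 1 - y * c₂) * b
                                  ≡ - (d₁ * a + d₂ * b) - b - y * (c₁ * a + c₂ * b)
  distrib = solve-∀

evalForms-act : ∀ x y a b bs v → evalForms a b (actForms x y bs v) ≡ act₂ x y a b bs (evalForms a b v)
evalForms-act x y a b []       v = refl
evalForms-act x y a b (s ∷ bs) v =
  trans (evalForms-reflect x y a b s (actForms x y bs v)) (cong (reflect₂ x y a b s) (evalForms-act x y a b bs v))

zeroForms : LinearForms
zeroForms = ((+ 0 , + 0) , (+ 0 , + 0))

evalForms-zero : ∀ a b → evalForms a b zeroForms ≡ (+ 0 , + 0)
evalForms-zero a b = cong₂ _,_ (zero-form a b) (zero-form a b)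
  where
  zero-form : ∀ a b → + 0 * a + + 0 * b ≡ + 0
  zero-form = solve-∀

actForms-braid : ∀ {x y m} → FiniteType x y m → actForms x y (braidWord m) zeroForms ≡ zeroForms
actForms-braid A₁×A₁ = refl
actForms-braid A₂    = refl
actForms-braid B₂    = refl
actForms-braid C₂    = refl
actForms-braid G₂    = refl
actForms-braid G₂′   = refl

act₂-braid : ∀ {x y m} → FiniteType x y m → ∀ a b → act₂ x y a b (braidWord m) (+ 0 , + 0) ≡ (+ 0 , + 0)
act₂-braid {x} {y} {m} t a b = begin
  act₂ x y a b (braidWord m) (+ 0 , + 0)                ≡⟨ cong (act₂ x y a b (braidWord m)) (sym (evalForms-zero a b)) ⟩
  act₂ x y a b (braidWord m) (evalForms a b zeroForms)  ≡⟨ sym (evalForms-act x y a b (braidWord m) zeroForms) ⟩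
  evalForms a b (actForms x y (braidWord m) zeroForms)  ≡⟨ cong (evalForms a b) (actForms-braid t) ⟩
  evalForms a b zeroForms                               ≡⟨ evalForms-zero a b ⟩
  (+ 0 , + 0)                                           ∎
  where open ≡-Reasoning

module RankTwo {N : ℕ} (A : Matrix N) (diag : ∀ i → A i i ≡ + 2)
               (i j : Fin N) {x y : ℤ} (Aij≡x : A i j ≡ x) (Aji≡y : A j i ≡ y) where

  open Action A
  open Dihedral A i j

  span : ℤ² → Lat N
  span v = linComb (proj₁ v) (e i) (proj₂ v) (e j)

  pair-span : ∀ k c d → pair A k (span (c , d)) ≡ c * A k i + d * A k j
  pair-span k c d = trans (pair-linComb k c (e i) d (e j)) (cong₂ (λ u v → c * u + d * v) (pair-e k i) (pair-e k j))

  pair-+ : ∀ k (μ ν : Lat N) → pair A k (λ t → μ t + ν t) ≡ pair A k μ + pair A k ν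
  pair-+ k μ ν = trans (pair-cong k (λ t → sym (ones (μ t) (ν t))))
                       (trans (pair-linComb k (+ 1) μ (+ 1) ν) (ones (pair A k μ) (pair A k ν)))
    where
    ones : ∀ a b → + 1 * a + + 1 * b ≡ a + b
    ones = solve-∀

  sref-span : ∀ s (μ : Lat N) v → sref A (letter s) (λ t → μ t + span v t) ≗
              (λ t → μ t + span (reflect₂ x y (pair A i μ) (pair A j μ) s v) t)
  sref-span true μ (c , d) t
    rewrite pair-+ i μ (span (c , d)) | pair-span i c d | diag i | Aij≡x =
    reflect (μ t) c d (pair A i μ) x (e i t) (e j t)
    where
    reflect : ∀ m c d a x ε ε′ → m + (c * ε + d * ε′) - (a + (c * + 2 + d * x)) * ε ≡ m + ((- c - a - x * d) * ε + d * ε′)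
    reflect = solve-∀
  sref-span false μ (c , d) t
    rewrite pair-+ j μ (span (c , d)) | pair-span j c d | diag j | Aji≡y =
    reflect (μ t) c d (pair A j μ) y (e i t) (e j t)
    where
    reflect : ∀ m c d b y ε ε′ → m + (c * ε + d * ε′) - (b + (c * y + d * + 2)) * ε′ ≡ m + (c * ε + (- d - b - y * c) * ε′)
    reflect = solve-∀

  act-span : ∀ bs (μ : Lat N) v → act A (Letters bs) (λ t → μ t + span v t) ≗
             (λ t → μ t + span (act₂ x y (pair A i μ) (pair A j μ) bs v) t)
  act-span []       μ v t = refl
  act-span (s ∷ bs) μ v t = trans (sref-cong (letter s) (act-span bs μ v) t) (sref-span s μ _ t)

  act-span₀ : ∀ bs v → act A (Letters bs) (span v) ≗ span (act₂ x y (+ 0) (+ 0) bs v)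
  act-span₀ bs v t = begin
    act A (Letters bs) (span v) t
      ≡⟨ act-cong (Letters bs) (λ s → sym (ℤₚ.+-identityˡ (span v s))) t ⟩
    act A (Letters bs) (λ s → 0ᴸ s + span v s) t
      ≡⟨ act-span bs 0ᴸ v t ⟩
    + 0 + span (act₂ x y (pair A i 0ᴸ) (pair A j 0ᴸ) bs v) t
      ≡⟨ ℤₚ.+-identityˡ _ ⟩
    span (act₂ x y (pair A i 0ᴸ) (pair A j 0ᴸ) bs v) t
      ≡⟨ cong₂ (λ a b → span (act₂ x y a b bs v) t) (pair-0 i) (pair-0 j) ⟩
    span (act₂ x y (+ 0) (+ 0) bs v) t ∎
    where
    open ≡-Reasoning
    0ᴸ : Lat N
    0ᴸ _ = + 0
    pair-0 : ∀ k → pair A k 0ᴸ ≡ + 0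
    pair-0 k = trans (∑-cong (λ t → ℤₚ.*-zeroʳ (A k t))) (∑-zero N)

  e-span : ∀ s → e (letter s) ≗ span (unit₂ s)
  e-span true  t = sym (ones (e i t) (e j t))
    where
    ones : ∀ a b → + 1 * a + + 0 * b ≡ a
    ones = solve-∀
  e-span false t = sym (ones (e i t) (e j t))
    where
    ones : ∀ a b → + 0 * a + + 1 * b ≡ b
    ones = solve-∀

  act-e-span : ∀ bs s → act A (Letters bs) (e (letter s)) ≗ span (act₂ x y (+ 0) (+ 0) bs (unit₂ s))
  act-e-span bs s t = trans (act-cong (Letters bs) (e-span s) t) (act-span₀ bs (unit₂ s) t)

  act-braid : ∀ {m} → FiniteType x y m → ∀ (μ : Lat N) → act A (Letters (braidWord m)) μ ≗ μ
  act-braid {m} t μ s = begin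
    act A (Letters (braidWord m)) μ s
      ≡⟨ act-cong (Letters (braidWord m)) (λ s → sym (plus-zero (μ s) (e i s) (e j s))) s ⟩
    act A (Letters (braidWord m)) (λ s → μ s + span (+ 0 , + 0) s) s
      ≡⟨ act-span (braidWord m) μ (+ 0 , + 0) s ⟩
    μ s + span (act₂ x y (pair A i μ) (pair A j μ) (braidWord m) (+ 0 , + 0)) s
      ≡⟨ cong (λ v → μ s + span v s) (act₂-braid t _ _) ⟩
    μ s + span (+ 0 , + 0) s
      ≡⟨ plus-zero (μ s) (e i s) (e j s) ⟩
    μ s ∎
    where
    open ≡-Reasoning
    plus-zero : ∀ m a b → m + (+ 0 * a + + 0 * b) ≡ m
    plus-zero = solve-∀

NonNeg₂ : ℤ² → Set
NonNeg₂ (c , d) = + 0 ℤ.≤ c × + 0 ℤ.≤ d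

NonNeg₂? : ∀ v → Dec (NonNeg₂ v)
NonNeg₂? (c , d) = (+ 0 ℤ.≤? c) ×-dec (+ 0 ℤ.≤? d)

alternatingRoot : (x y : ℤ) → ℕ → ℤ²
alternatingRoot x y k = act₂ x y (+ 0) (+ 0) (alternating false k) (+ 1 , + 0)

alternatingRoot-finite : ∀ {x y m} → FiniteType x y m → ∀ {k} → k < m → NonNeg₂ (alternatingRoot x y k)
alternatingRoot-finite A₁×A₁ = from-yes (ℕₚ.allUpTo? (NonNeg₂? ∘ alternatingRoot (+ 0) (+ 0)) 2)
alternatingRoot-finite A₂    = from-yes (ℕₚ.allUpTo? (NonNeg₂? ∘ alternatingRoot -[1+ 0 ] -[1+ 0 ]) 3)
alternatingRoot-finite B₂    = from-yes (ℕₚ.allUpTo? (NonNeg₂? ∘ alternatingRoot -[1+ 0 ] -[1+ 1 ]) 4)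
alternatingRoot-finite C₂    = from-yes (ℕₚ.allUpTo? (NonNeg₂? ∘ alternatingRoot -[1+ 1 ] -[1+ 0 ]) 4)
alternatingRoot-finite G₂    = from-yes (ℕₚ.allUpTo? (NonNeg₂? ∘ alternatingRoot -[1+ 0 ] -[1+ 2 ]) 6)
alternatingRoot-finite G₂′   = from-yes (ℕₚ.allUpTo? (NonNeg₂? ∘ alternatingRoot -[1+ 2 ] -[1+ 0 ]) 6)

module InfiniteType (a b : ℕ) (4≤PQ : 4 ≤ suc a ℕ.* suc b) where

  P Q : ℕ
  P = suc a
  Q = suc b

  -- Holds after a reflection s_i (true) or s_j (false); as a_ij a_ji ≥ 4, the next reflection preserves it
  -- and keeps both coordinates in ℕ.
  Invariant : Bool → ℕ → ℕ → Set
  Invariant true  c d = P ℕ.* d ≤ 2 ℕ.* c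
  Invariant false c d = Q ℕ.* c ≤ 2 ℕ.* d

  private
    twice-≤ : ∀ P Q c d → 4 ≤ P ℕ.* Q → Q ℕ.* c ≤ 2 ℕ.* d → 2 ℕ.* c ≤ P ℕ.* d
    twice-≤ P Q c d 4≤PQ Qc≤2d = ℕₚ.*-cancelˡ-≤ 2 (begin
      2 ℕ.* (2 ℕ.* c)  ≡⟨ sym (ℕₚ.*-assoc 2 2 c) ⟩
      4 ℕ.* c          ≤⟨ ℕₚ.*-monoˡ-≤ c 4≤PQ ⟩
      P ℕ.* Q ℕ.* c    ≡⟨ ℕₚ.*-assoc P Q c ⟩
      P ℕ.* (Q ℕ.* c)  ≤⟨ ℕₚ.*-monoʳ-≤ P Qc≤2d ⟩
      P ℕ.* (2 ℕ.* d)  ≡⟨ ℕₚ.*-comm P (2 ℕ.* d) ⟩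
      2 ℕ.* d ℕ.* P    ≡⟨ ℕₚ.*-assoc 2 d P ⟩
      2 ℕ.* (d ℕ.* P)  ≡⟨ cong (2 ℕ.*_) (ℕₚ.*-comm d P) ⟩
      2 ℕ.* (P ℕ.* d)  ∎)
      where open ℕₚ.≤-Reasoning

    reflected-≤ : ∀ n c → 2 ℕ.* c ≤ n → c ≤ n × n ≤ 2 ℕ.* (n ∸ c)
    reflected-≤ n c 2c≤n = ℕₚ.≤-trans (ℕₚ.m≤m+n c (c ℕ.+ 0)) 2c≤n , n≤2[n∸c]
      where
      n≤2[n∸c] : n ≤ 2 ℕ.* (n ∸ c)
      n≤2[n∸c] rewrite ℕₚ.*-distribˡ-∸ 2 n c =
        ℕₚ.m+n≤o⇒m≤o∸n n (ℕₚ.≤-trans (ℕₚ.+-monoʳ-≤ n 2c≤n) (ℕₚ.≤-reflexive (cong (n ℕ.+_) (sym (ℕₚ.+-identityʳ n)))))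

    reflect-coordinate : ∀ p c d → c ≤ suc p ℕ.* d → - (+ c) - + 0 - -[1+ p ] * + d ≡ + (suc p ℕ.* d ∸ c)
    reflect-coordinate p c d c≤ = begin
      - (+ c) - + 0 - -[1+ p ] * + d   ≡⟨ cong (λ z → - (+ c) - + 0 - z) (ℤₚ.neg-distribˡ-* (+ suc p) (+ d)) ⟨
      - (+ c) - + 0 - - (+ suc p * + d) ≡⟨ cong (λ z → - (+ c) - + 0 - - z) (ℤₚ.pos-* (suc p) d) ⟨
      - (+ c) - + 0 - - + (suc p ℕ.* d) ≡⟨ simplify (+ c) (+ (suc p ℕ.* d)) ⟩
      - (+ c) + + (suc p ℕ.* d)         ≡⟨ ℤₚ.-m+n≡n⊖m c (suc p ℕ.* d) ⟩
      suc p ℕ.* d ⊖ c                   ≡⟨ ℤₚ.⊖-≥ c≤ ⟩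
      + (suc p ℕ.* d ∸ c)               ∎
      where
      open ≡-Reasoning
      simplify : ∀ c n → - c - + 0 - - n ≡ - c + n
      simplify = solve-∀

  reflect-Invariant : ∀ s c d → Invariant (not s) c d →
    ∃₂ λ c′ d′ → reflect₂ -[1+ a ] -[1+ b ] (+ 0) (+ 0) s (+ c , + d) ≡ (+ c′ , + d′) × Invariant s c′ d′
  reflect-Invariant true c d inv = P ℕ.* d ∸ c , d , cong (_, + d) (reflect-coordinate a c d c≤) , bound
    where
    c≤×bound = reflected-≤ (P ℕ.* d) c (twice-≤ P Q c d 4≤PQ inv)
    c≤ = proj₁ c≤×bound
    bound = proj₂ c≤×bound
  reflect-Invariant false c d inv = c , Q ℕ.* c ∸ d , cong (+ c ,_) (reflect-coordinate b d c d≤) , bound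
    where
    d≤×bound = reflected-≤ (Q ℕ.* c) d (twice-≤ Q P d c (subst (4 ≤_) (ℕₚ.*-comm P Q) 4≤PQ) inv)
    d≤ = proj₁ d≤×bound
    bound = proj₂ d≤×bound

  act₂-alternating-ℕ : ∀ k s c d → Invariant s c d →
    ∃₂ λ c′ d′ → act₂ -[1+ a ] -[1+ b ] (+ 0) (+ 0) (alternating (not s) k) (+ c , + d) ≡ (+ c′ , + d′)
  act₂-alternating-ℕ zero s c d inv = c , d , refl
  act₂-alternating-ℕ (suc k) s c d inv
    with reflect-Invariant (not s) c d (subst (λ s′ → Invariant s′ c d) (sym (not-involutive s)) inv)
  ... | c₁ , d₁ , reflected , inv₁ with act₂-alternating-ℕ k (not s) c₁ d₁ inv₁
  ...   | c₂ , d₂ , rest = c₂ , d₂ , (begin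
    act₂ x y (+ 0) (+ 0) (alternating (not s) (suc k)) (+ c , + d)
      ≡⟨ cong (λ w → act₂ x y (+ 0) (+ 0) w (+ c , + d)) (alternating-∷ʳ (not s) k) ⟩
    act₂ x y (+ 0) (+ 0) (alternating (not (not s)) k ∷ʳ not s) (+ c , + d)
      ≡⟨ act₂-++ x y (+ 0) (+ 0) (alternating (not (not s)) k) (not s ∷ []) (+ c , + d) ⟩
    act₂ x y (+ 0) (+ 0) (alternating (not (not s)) k) (reflect₂ x y (+ 0) (+ 0) (not s) (+ c , + d))
      ≡⟨ cong (act₂ x y (+ 0) (+ 0) (alternating (not (not s)) k)) reflected ⟩
    act₂ x y (+ 0) (+ 0) (alternating (not (not s)) k) (+ c₁ , + d₁)
      ≡⟨ rest ⟩
    (+ c₂ , + d₂) ∎)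
    where
    open ≡-Reasoning
    x = -[1+ a ]
    y = -[1+ b ]

  alternatingRoot-infinite : ∀ k → NonNeg₂ (alternatingRoot -[1+ a ] -[1+ b ] k)
  alternatingRoot-infinite k with act₂-alternating-ℕ k true 1 0 (subst (ℕ._≤ 2) (sym (ℕₚ.*-zeroʳ P)) z≤n)
  ... | c , d , eq rewrite eq = +≤+ z≤n , +≤+ z≤n

module _ {N : ℕ} (A : Matrix N) (gcm : IsGCM A) where

  open Action A
  open Words A

  Relator-finiteType : ∀ {i j m} → ¬ i ≡ j → coxM (A i j * A j i) ≡ just m → FiniteType (A i j) (A j i) m
  Relator-finiteType i≢j = finiteType (cartanPair gcm i≢j)

  act-Relator : ∀ {r} → Relator A r → ∀ μ → act A r μ ≗ μ
  act-Relator (square i) μ = sref-invol (proj₁ gcm) i μ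
  act-Relator (braid i j m i≢j eq) μ t =
    trans (cong (λ r → act A r μ t) (sym (Letters-braidWord m)))
          (act-braid (Relator-finiteType i≢j eq) μ t)
    where
    open Dihedral A i j using (Letters-braidWord)
    open RankTwo A (proj₁ gcm) i j refl refl using (act-braid)

  act-≈ : ∀ {u w} → u ≈ w → ∀ μ → act A u μ ≗ act A w μ
  act-≈ (del u r v R) μ t =
    trans (act-++ u (r ++ v) μ t)
      (trans (act-cong u (λ s → trans (act-++ r v μ s) (act-Relator R (act A v μ) s)) t) (sym (act-++ u v μ t)))
  act-≈ ≃refl        μ t = refl
  act-≈ (≃sym p)     μ t = sym (act-≈ p μ t)
  act-≈ (≃trans p q) μ t = trans (act-≈ p μ t) (act-≈ q μ t)

-- Sums over masks

sumℤ-++ : ∀ xs ys → sumℤ (xs ++ ys) ≡ sumℤ xs + sumℤ ys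
sumℤ-++ []       ys = sym (ℤₚ.+-identityˡ _)
sumℤ-++ (x ∷ xs) ys = trans (cong (_+_ x) (sumℤ-++ xs ys)) (sym (ℤₚ.+-assoc x _ _))

module _ {B : Set} where

  ∑ᴸ : List B → (B → ℤ) → ℤ
  ∑ᴸ L g = sumℤ (map g L)

  ∑ᴸ-cong : ∀ L {g g′ : B → ℤ} → g ≗ g′ → ∑ᴸ L g ≡ ∑ᴸ L g′
  ∑ᴸ-cong []      g≗g′ = refl
  ∑ᴸ-cong (b ∷ L) g≗g′ = cong₂ _+_ (g≗g′ b) (∑ᴸ-cong L g≗g′)

  ∑ᴸ-distrib-+ : ∀ L (g g′ : B → ℤ) → ∑ᴸ L (λ b → g b + g′ b) ≡ ∑ᴸ L g + ∑ᴸ L g′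
  ∑ᴸ-distrib-+ []      g g′ = refl
  ∑ᴸ-distrib-+ (b ∷ L) g g′ =
    trans (cong (_+_ (g b + g′ b)) (∑ᴸ-distrib-+ L g g′)) (interchange (g b) (g′ b) (∑ᴸ L g) (∑ᴸ L g′))

  *-distribˡ-∑ᴸ : ∀ L c (g : B → ℤ) → c * ∑ᴸ L g ≡ ∑ᴸ L (λ b → c * g b)
  *-distribˡ-∑ᴸ []      c g = ℤₚ.*-zeroʳ c
  *-distribˡ-∑ᴸ (b ∷ L) c g = trans (ℤₚ.*-distribˡ-+ c (g b) _) (cong (_+_ (c * g b)) (*-distribˡ-∑ᴸ L c g))

  ∑ᴸ-zero : ∀ L (g : B → ℤ) → (∀ b → g b ≡ + 0) → ∑ᴸ L g ≡ + 0
  ∑ᴸ-zero []      g g≗0 = refl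
  ∑ᴸ-zero (b ∷ L) g g≗0 = cong₂ _+_ (g≗0 b) (∑ᴸ-zero L g g≗0)

  ∑ᴸ-++ : ∀ L L′ (g : B → ℤ) → ∑ᴸ (L ++ L′) g ≡ ∑ᴸ L g + ∑ᴸ L′ g
  ∑ᴸ-++ L L′ g = trans (cong sumℤ (map-++ g L L′)) (sumℤ-++ (map g L) (map g L′))

∑ᴸ-map : ∀ {B C : Set} (L : List B) (k : B → C) (g : C → ℤ) → ∑ᴸ (map k L) g ≡ ∑ᴸ L (g ∘′ k)
∑ᴸ-map []      k g = refl
∑ᴸ-map (b ∷ L) k g = cong (_+_ (g (k b))) (∑ᴸ-map L k g)

∑ᴸ-comm : ∀ {B C : Set} (L : List B) (L′ : List C) (g : B → C → ℤ) →
          ∑ᴸ L (λ b → ∑ᴸ L′ (g b)) ≡ ∑ᴸ L′ (λ c → ∑ᴸ L (λ b → g b c))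
∑ᴸ-comm []      L′ g = sym (∑ᴸ-zero L′ _ (λ _ → refl))
∑ᴸ-comm (b ∷ L) L′ g = trans (cong (_+_ (∑ᴸ L′ (g b))) (∑ᴸ-comm L L′ g)) (sym (∑ᴸ-distrib-+ L′ (g b) _))

∑ᴹ : (m : ℕ) → (Vec Bool m → ℤ) → ℤ
∑ᴹ m = ∑ᴸ (allMasks m)

∑ᴹ-suc : ∀ m (g : Vec Bool (suc m) → ℤ) → ∑ᴹ (suc m) g ≡ ∑ᴹ m (λ ε → g (false ∷ ε)) + ∑ᴹ m (λ ε → g (true ∷ ε))
∑ᴹ-suc m g = trans (∑ᴸ-++ (map (false ∷_) (allMasks m)) (map (true ∷_) (allMasks m)) g)
                   (cong₂ _+_ (∑ᴸ-map (allMasks m) (false ∷_) g) (∑ᴸ-map (allMasks m) (true ∷_) g))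

∑ᴹ-cong : ∀ m {g g′ : Vec Bool m → ℤ} → g ≗ g′ → ∑ᴹ m g ≡ ∑ᴹ m g′
∑ᴹ-cong m = ∑ᴸ-cong (allMasks m)

*-distribˡ-∑ᴹ : ∀ m c (g : Vec Bool m → ℤ) → c * ∑ᴹ m g ≡ ∑ᴹ m (λ ε → c * g ε)
*-distribˡ-∑ᴹ m = *-distribˡ-∑ᴸ (allMasks m)

∑ᴹ-zero : ∀ m (g : Vec Bool m → ℤ) → (∀ ε → g ε ≡ + 0) → ∑ᴹ m g ≡ + 0
∑ᴹ-zero m = ∑ᴸ-zero (allMasks m)

∑ᴹ-comm : ∀ m n (g : Vec Bool m → Vec Bool n → ℤ) → ∑ᴹ m (λ ε → ∑ᴹ n (g ε)) ≡ ∑ᴹ n (λ ε′ → ∑ᴹ m (λ ε → g ε ε′))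
∑ᴹ-comm m n = ∑ᴸ-comm (allMasks m) (allMasks n)

module _ {X : Set} where

  -- Masks of a concatenated walk p ++ s are indexed by Vec Bool (length (p ++ s)), not by a Vec-append.
  appendMask : ∀ (p : List X) {s : List X} → Vec Bool (length p) → Vec Bool (length s) → Vec Bool (length (p ++ s))
  appendMask []      []       εs = εs
  appendMask (a ∷ p) (b ∷ εp) εs = b ∷ appendMask p εp εs

  ∑ᴹ-++ : ∀ p s (g : Vec Bool (length (p ++ s)) → ℤ) →
          ∑ᴹ (length (p ++ s)) g ≡ ∑ᴹ (length p) (λ εp → ∑ᴹ (length s) (λ εs → g (appendMask p εp εs)))
  ∑ᴹ-++ []      s g = sym (ℤₚ.+-identityʳ _)
  ∑ᴹ-++ (a ∷ p) s g = begin
    ∑ᴹ (suc (length (p ++ s))) g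
      ≡⟨ ∑ᴹ-suc (length (p ++ s)) g ⟩
    ∑ᴹ (length (p ++ s)) (λ ε → g (false ∷ ε)) + ∑ᴹ (length (p ++ s)) (λ ε → g (true ∷ ε))
      ≡⟨ cong₂ _+_ (∑ᴹ-++ p s (λ ε → g (false ∷ ε))) (∑ᴹ-++ p s (λ ε → g (true ∷ ε))) ⟩
    ∑ᴹ (length p) (λ εp → ∑ᴹ (length s) (λ εs → g (false ∷ appendMask p εp εs)))
      + ∑ᴹ (length p) (λ εp → ∑ᴹ (length s) (λ εs → g (true ∷ appendMask p εp εs)))
      ≡⟨ sym (∑ᴹ-suc (length p) (λ εp → ∑ᴹ (length s) (λ εs → g (appendMask (a ∷ p) εp εs)))) ⟩
    ∑ᴹ (suc (length p)) (λ εp → ∑ᴹ (length s) (λ εs → g (appendMask (a ∷ p) εp εs))) ∎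
    where open ≡-Reasoning

  masked-appendMask : ∀ p {s : List X} (εp : Vec Bool (length p)) (εs : Vec Bool (length s)) →
                      masked (p ++ s) (appendMask p εp εs) ≡ masked p εp ++ masked s εs
  masked-appendMask []      []          εs = refl
  masked-appendMask (a ∷ p) (true ∷ εp)  εs = cong (a ∷_) (masked-appendMask p εp εs)
  masked-appendMask (a ∷ p) (false ∷ εp) εs = masked-appendMask p εp εs

  support≡length-masked : ∀ (γ : List X) (ε : Vec Bool (length γ)) → support ε ≡ length (masked γ ε)
  support≡length-masked []      []          = refl
  support≡length-masked (a ∷ γ) (true ∷ ε)  = cong suc (support≡length-masked γ ε)
  support≡length-masked (a ∷ γ) (false ∷ ε) = support≡length-masked γ ε

module MaskSums {N : ℕ} (A : Matrix N) (x : Fin N → ℤ) where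

  open Action A
  open Words A

  -- Ψ^ε (evaluated at x) of the walk of type γ starting at the alcove P, the step from u to u s_k labelled u α_k.
  Ψ : Word → (γ : Word) → Vec Bool (length γ) → ℤ
  Ψ P []      []          = + 1
  Ψ P (k ∷ γ) (true ∷ ε)  = ev (act A P (e k)) x * Ψ (P ∷ʳ k) γ ε
  Ψ P (k ∷ γ) (false ∷ ε) = Ψ (P ∷ʳ k) γ ε

  SameAction : Word → Word → Set
  SameAction P P′ = ∀ μ → act A P μ ≗ act A P′ μ

  SameAction-∷ʳ : ∀ {P P′} k → SameAction P P′ → SameAction (P ∷ʳ k) (P′ ∷ʳ k)
  SameAction-∷ʳ {P} {P′} k same μ t =
    trans (act-++ P (k ∷ []) μ t) (trans (same _ t) (sym (act-++ P′ (k ∷ []) μ t)))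

  SameAction-≡ : ∀ {P P′} → P ≡ P′ → SameAction P P′
  SameAction-≡ refl μ t = refl

  Ψ-cong : ∀ {P P′} → SameAction P P′ → ∀ γ ε → Ψ P γ ε ≡ Ψ P′ γ ε
  Ψ-cong same []      []          = refl
  Ψ-cong {P} {P′} same (k ∷ γ) (true ∷ ε)  =
    cong₂ _*_ (ev-cong (same (e k)) x) (Ψ-cong (SameAction-∷ʳ {P} {P′} k same) γ ε)
  Ψ-cong {P} {P′} same (k ∷ γ) (false ∷ ε) = Ψ-cong (SameAction-∷ʳ {P} {P′} k same) γ ε

  Ψ-appendMask : ∀ P p {s} (εp : Vec Bool (length p)) (εs : Vec Bool (length s)) →
                 Ψ P (p ++ s) (appendMask p εp εs) ≡ Ψ P p εp * Ψ (P ++ p) s εs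
  Ψ-appendMask P []      {s} []          εs =
    trans (Ψ-cong (λ μ t → sym (act-++ P [] μ t)) s εs) (sym (ℤₚ.*-identityˡ _))
  Ψ-appendMask P (k ∷ p) {s} (true ∷ εp) εs = begin
    ev (act A P (e k)) x * Ψ (P ∷ʳ k) (p ++ s) (appendMask p εp εs)
      ≡⟨ cong (ev (act A P (e k)) x *_) (Ψ-appendMask (P ∷ʳ k) p εp εs) ⟩
    ev (act A P (e k)) x * (Ψ (P ∷ʳ k) p εp * Ψ (P ∷ʳ k ++ p) s εs)
      ≡⟨ cong (λ z → ev (act A P (e k)) x * (Ψ (P ∷ʳ k) p εp * z)) (Ψ-cong (SameAction-≡ (++-assoc P (k ∷ []) p)) s εs) ⟩
    ev (act A P (e k)) x * (Ψ (P ∷ʳ k) p εp * Ψ (P ++ k ∷ p) s εs)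
      ≡⟨ sym (ℤₚ.*-assoc (ev (act A P (e k)) x) _ _) ⟩
    ev (act A P (e k)) x * Ψ (P ∷ʳ k) p εp * Ψ (P ++ k ∷ p) s εs ∎
    where open ≡-Reasoning
  Ψ-appendMask P (k ∷ p) {s} (false ∷ εp) εs =
    trans (Ψ-appendMask (P ∷ʳ k) p εp εs)
          (cong (Ψ (P ∷ʳ k) p εp *_) (Ψ-cong (SameAction-≡ (++-assoc P (k ∷ []) p)) s εs))

  Ψ-appendMask₃ : ∀ p r q → (∀ μ → act A r μ ≗ μ) → ∀ εp εr εq →
                  Ψ [] (p ++ r ++ q) (appendMask p εp (appendMask r εr εq)) ≡ Ψ [] p εp * (Ψ p r εr * Ψ p q εq)
  Ψ-appendMask₃ p r q r-invisible εp εr εq = begin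
    Ψ [] (p ++ r ++ q) (appendMask p εp (appendMask r εr εq)) ≡⟨ Ψ-appendMask [] p εp _ ⟩
    Ψ [] p εp * Ψ p (r ++ q) (appendMask r εr εq)             ≡⟨ cong (Ψ [] p εp *_) (Ψ-appendMask p r εr εq) ⟩
    Ψ [] p εp * (Ψ p r εr * Ψ (p ++ r) q εq)                 ≡⟨ cong (λ z → Ψ [] p εp * (Ψ p r εr * z)) (Ψ-cong pr∼p q εq) ⟩
    Ψ [] p εp * (Ψ p r εr * Ψ p q εq)                        ∎
    where
    open ≡-Reasoning
    pr∼p : SameAction (p ++ r) p
    pr∼p μ t = trans (act-++ p r μ t) (act-cong p (r-invisible μ) t)

  CanonicalLabels : Word → (γ : Word) → (Fin (length γ) → Lat N) → Set
  CanonicalLabels P γ β = ∀ (t : Fin (length γ)) → β t ≗ act A (P ++ take (toℕ t) γ) (e (lookup γ t))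

  CanonicalLabels-tail : ∀ P k γ β → CanonicalLabels P (k ∷ γ) β → CanonicalLabels (P ∷ʳ k) γ (β ∘′ suc)
  CanonicalLabels-tail P k γ β canonical t s =
    trans (canonical (suc t) s) (SameAction-≡ (sym (++-assoc P (k ∷ []) (take (toℕ t) γ))) _ s)

  psiAt-canonical : ∀ P γ β → CanonicalLabels P γ β → ∀ ε → psiAt γ β x ε ≡ Ψ P γ ε
  psiAt-canonical P []      β canonical []          = refl
  psiAt-canonical P (k ∷ γ) β canonical (true ∷ ε)  =
    cong₂ _*_ (ev-cong (λ t → trans (canonical zero t) (act-++ P [] (e k) t)) x)
              (psiAt-canonical (P ∷ʳ k) γ (β ∘′ suc) (CanonicalLabels-tail P k γ β canonical) ε)
  psiAt-canonical P (k ∷ γ) β canonical (false ∷ ε) =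
    psiAt-canonical (P ∷ʳ k) γ (β ∘′ suc) (CanonicalLabels-tail P k γ β canonical) ε

  TestFunction : (Word → ℤ) → Set
  TestFunction T = (∀ z z′ → z ≈ z′ → length z ≡ length z′ → T z ≡ T z′) × (∀ z → Reducible z → T z ≡ + 0)

  TestFunction-infix : ∀ {T} u w → TestFunction T → TestFunction (λ z → T (u ++ z ++ w))
  TestFunction-infix {T} u w (T-≈ , T-reducible) = T-≈-infix , λ z r → T-reducible _ (Reducible-infix u w r)
    where
    T-≈-infix : ∀ z z′ → z ≈ z′ → length z ≡ length z′ → T (u ++ z ++ w) ≡ T (u ++ z′ ++ w)
    T-≈-infix z z′ z≈z′ |z|≡|z′| = T-≈ _ _ (≈-cong u w z≈z′) (begin
      length (u ++ z ++ w)              ≡⟨ length-++ u ⟩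
      length u ℕ.+ length (z ++ w)      ≡⟨ cong (length u ℕ.+_) (length-++ z) ⟩
      length u ℕ.+ (length z ℕ.+ length w)  ≡⟨ cong (λ n → length u ℕ.+ (n ℕ.+ length w)) |z|≡|z′| ⟩
      length u ℕ.+ (length z′ ℕ.+ length w) ≡⟨ cong (length u ℕ.+_) (length-++ z′) ⟨
      length u ℕ.+ length (z′ ++ w)     ≡⟨ length-++ u ⟨
      length (u ++ z′ ++ w)             ∎)
      where open ≡-Reasoning

  -- Summed over its masks, an occurrence of r in a walk contributes as if r were absent.
  LocallyTrivial : Word → Set
  LocallyTrivial r = ∀ P T → TestFunction T → ∑ᴹ (length r) (λ ε → Ψ P r ε * T (masked r ε)) ≡ T []

  square-trivial : (∀ i → A i i ≡ + 2) → ∀ i → LocallyTrivial (i ∷ i ∷ [])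
  square-trivial diag i P T (_ , T-reducible)
    rewrite T-reducible (i ∷ i ∷ []) ([] , cancel-square [] i [] , s≤s z≤n)
          | trans (ev-cong (act-∷ʳ-self diag P i) x) (ev-neg (act A P (e i)) x) =
    cancel (T []) (T (i ∷ [])) (ev (act A P (e i)) x)
    where
    cancel : ∀ t₀ t₁ a → + 1 * t₀ + ((- a * + 1) * t₁ + ((a * + 1) * t₁ + ((a * (- a * + 1)) * + 0 + + 0))) ≡ t₀
    cancel = solve-∀

  module Weighted (dec : ∀ u v → Dec (u ≈ v)) (v : Word) (l : ℕ) (ℓv≡l : IsLength A v l) where

    weight : Word → ℤ
    weight z = if (length z ≡ᵇ l) ∧ does (dec z v) then + 1 else + 0

    weight-TestFunction : TestFunction weight
    weight-TestFunction = weight-≈ , weight-reducible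
      where
      weight-≈ : ∀ z z′ → z ≈ z′ → length z ≡ length z′ → weight z ≡ weight z′
      weight-≈ z z′ z≈z′ |z|≡|z′| rewrite |z|≡|z′| with dec z v | dec z′ v
      ... | yes _   | yes _    = refl
      ... | no _    | no _     = refl
      ... | yes z≈v | no z′≉v  = ⊥-elim (z′≉v (≃trans (≃sym z≈z′) z≈v))
      ... | no z≉v  | yes z′≈v = ⊥-elim (z≉v (≃trans z≈z′ z′≈v))
      weight-reducible : ∀ z → Reducible z → weight z ≡ + 0
      weight-reducible z (z′ , z≈z′ , shorter) with length z ≡ᵇ l in |z|≡ᵇl | dec z v
      ... | false | _       = refl
      ... | true  | no _    = refl
      ... | true  | yes z≈v = ⊥-elim (IsLength-no-shorter ℓv≡l (≃trans (≃sym z≈z′) z≈v)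
                                       (subst (length z′ <_) (ℕₚ.≡ᵇ⇒≡ (length z) l (subst Bool.T (sym |z|≡ᵇl) _)) shorter))

    weightedSum : Word → ℤ
    weightedSum γ = ∑ᴹ (length γ) (λ ε → Ψ [] γ ε * weight (masked γ ε))

    maskSum≡weightedSum : ∀ γ β → CanonicalLabels [] γ β → maskSum A dec γ β v l x ≡ weightedSum γ
    maskSum≡weightedSum γ β canonical = ∑ᴹ-cong (length γ) term≡
      where
      if-* : ∀ b X → (if b then X else + 0) ≡ X * (if b then + 1 else + 0)
      if-* true  X = sym (ℤₚ.*-identityʳ X)
      if-* false X = sym (ℤₚ.*-zeroʳ X)
      term≡ : ∀ ε → (if (support ε ≡ᵇ l) ∧ does (dec (masked γ ε) v) then psiAt γ β x ε else + 0)
                    ≡ Ψ [] γ ε * weight (masked γ ε)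
      term≡ ε rewrite support≡length-masked γ ε | psiAt-canonical [] γ β canonical ε =
        if-* ((length (masked γ ε) ≡ᵇ l) ∧ does (dec (masked γ ε) v)) _

    weightedSum-delete : ∀ p r q → LocallyTrivial r → (∀ μ → act A r μ ≗ μ) →
                         weightedSum (p ++ r ++ q) ≡ weightedSum (p ++ q)
    weightedSum-delete p r q r-trivial r-invisible = begin
      weightedSum (p ++ r ++ q)
        ≡⟨ ∑ᴹ-++ p (r ++ q) term ⟩
      ∑ᴹ (length p) (λ εp → ∑ᴹ (length (r ++ q)) (λ ε → term (appendMask p εp ε)))
        ≡⟨ ∑ᴹ-cong (length p) (λ εp → ∑ᴹ-++ r q _) ⟩
      ∑ᴹ (length p) (λ εp → ∑ᴹ (length r) (λ εr → ∑ᴹ (length q) (λ εq → term (split εp εr εq))))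
        ≡⟨ ∑ᴹ-cong (length p) (λ εp → ∑ᴹ-comm (length r) (length q) _) ⟩
      ∑ᴹ (length p) (λ εp → ∑ᴹ (length q) (λ εq → ∑ᴹ (length r) (λ εr → term (split εp εr εq))))
        ≡⟨ ∑ᴹ-cong (length p) (λ εp → ∑ᴹ-cong (length q) (sum-over-r εp)) ⟩
      ∑ᴹ (length p) (λ εp → ∑ᴹ (length q) (λ εq → term′ (appendMask p εp εq)))
        ≡⟨ sym (∑ᴹ-++ p q term′) ⟩
      weightedSum (p ++ q) ∎
      where
      open ≡-Reasoning
      term : Vec Bool (length (p ++ r ++ q)) → ℤ
      term ε = Ψ [] (p ++ r ++ q) ε * weight (masked (p ++ r ++ q) ε)
      term′ : Vec Bool (length (p ++ q)) → ℤ
      term′ ε = Ψ [] (p ++ q) ε * weight (masked (p ++ q) ε)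
      split : Vec Bool (length p) → Vec Bool (length r) → Vec Bool (length q) → Vec Bool (length (p ++ r ++ q))
      split εp εr εq = appendMask p εp (appendMask r εr εq)
      rearrange : ∀ a b c w → a * (b * c) * w ≡ a * c * (b * w)
      rearrange = solve-∀
      factor : ∀ εp εr εq → term (split εp εr εq)
             ≡ Ψ [] p εp * Ψ p q εq * (Ψ p r εr * weight (masked p εp ++ masked r εr ++ masked q εq))
      factor εp εr εq =
        trans (cong₂ _*_ (Ψ-appendMask₃ p r q r-invisible εp εr εq) (cong weight masked-split))
              (rearrange (Ψ [] p εp) (Ψ p r εr) (Ψ p q εq) _)
        where
        masked-split = trans (masked-appendMask p εp _) (cong (masked p εp ++_) (masked-appendMask r εr εq))
      sum-over-r : ∀ εp εq → ∑ᴹ (length r) (λ εr → term (split εp εr εq)) ≡ term′ (appendMask p εp εq)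
      sum-over-r εp εq = begin
        ∑ᴹ (length r) (λ εr → term (split εp εr εq))
          ≡⟨ ∑ᴹ-cong (length r) (λ εr → factor εp εr εq) ⟩
        ∑ᴹ (length r) (λ εr → c * (Ψ p r εr * T′ (masked r εr)))
          ≡⟨ sym (*-distribˡ-∑ᴹ (length r) c _) ⟩
        c * ∑ᴹ (length r) (λ εr → Ψ p r εr * T′ (masked r εr))
          ≡⟨ cong (c *_) (r-trivial p T′ (TestFunction-infix (masked p εp) (masked q εq) weight-TestFunction)) ⟩
        c * weight (masked p εp ++ masked q εq)
          ≡⟨ sym (cong₂ _*_ (Ψ-appendMask [] p εp εq) (cong weight (masked-appendMask p εp εq))) ⟩
        term′ (appendMask p εp εq) ∎
        where
        c = Ψ [] p εp * Ψ p q εq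
        T′ : Word → ℤ
        T′ z = weight (masked p εp ++ z ++ masked q εq)

-- Braid relators

-- A row [a₀, a₁, …] is the polynomial Σ aₗ Xˡ, a list of rows [r₀, r₁, …] the polynomial Σ Yᵏ rₖ(X).
Row Poly : Set
Row  = List ℤ
Poly = List Row

evalRow : Row → ℤ → ℤ
evalRow []      X = + 0
evalRow (a ∷ r) X = a + X * evalRow r X

evalPoly : Poly → ℤ → ℤ → ℤ
evalPoly []      X Y = + 0
evalPoly (r ∷ p) X Y = evalRow r X + Y * evalPoly p X Y

addRow : Row → Row → Row
addRow []      s       = s
addRow (a ∷ r) []      = a ∷ r
addRow (a ∷ r) (b ∷ s) = a + b ∷ addRow r s

addPoly : Poly → Poly → Poly
addPoly []      q       = q
addPoly (r ∷ p) []      = r ∷ p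
addPoly (r ∷ p) (s ∷ q) = addRow r s ∷ addPoly p q

scalePoly : ℤ → Poly → Poly
scalePoly c = map (map (c *_))

mulX mulY : Poly → Poly
mulX = map (+ 0 ∷_)
mulY = [] ∷_

linMul : ℤ² → Poly → Poly
linMul v p = addPoly (scalePoly (proj₁ v) (mulX p)) (scalePoly (proj₂ v) (mulY p))

onePoly : Poly
onePoly = (+ 1 ∷ []) ∷ []

isZeroRow : Row → Bool
isZeroRow []           = true
isZeroRow (+ zero ∷ r) = isZeroRow r
isZeroRow (_ ∷ r)      = false

isZeroPoly : Poly → Bool
isZeroPoly []      = true
isZeroPoly (r ∷ p) = isZeroRow r ∧ isZeroPoly p

evalRow-addRow : ∀ r s X → evalRow (addRow r s) X ≡ evalRow r X + evalRow s X
evalRow-addRow []      s       X = sym (ℤₚ.+-identityˡ _)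
evalRow-addRow (a ∷ r) []      X = sym (ℤₚ.+-identityʳ _)
evalRow-addRow (a ∷ r) (b ∷ s) X rewrite evalRow-addRow r s X = distrib a b X (evalRow r X) (evalRow s X)
  where
  distrib : ∀ a b X u v → a + b + X * (u + v) ≡ a + X * u + (b + X * v)
  distrib = solve-∀

evalPoly-addPoly : ∀ p q X Y → evalPoly (addPoly p q) X Y ≡ evalPoly p X Y + evalPoly q X Y
evalPoly-addPoly []      q       X Y = sym (ℤₚ.+-identityˡ _)
evalPoly-addPoly (r ∷ p) []      X Y = sym (ℤₚ.+-identityʳ _)
evalPoly-addPoly (r ∷ p) (s ∷ q) X Y rewrite evalRow-addRow r s X | evalPoly-addPoly p q X Y =
  distrib (evalRow r X) (evalRow s X) Y (evalPoly p X Y) (evalPoly q X Y)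
  where
  distrib : ∀ a b Y u v → a + b + Y * (u + v) ≡ a + Y * u + (b + Y * v)
  distrib = solve-∀

evalRow-scale : ∀ c r X → evalRow (map (c *_) r) X ≡ c * evalRow r X
evalRow-scale c []      X = sym (ℤₚ.*-zeroʳ c)
evalRow-scale c (a ∷ r) X rewrite evalRow-scale c r X = distrib c a X (evalRow r X)
  where
  distrib : ∀ c a X u → c * a + X * (c * u) ≡ c * (a + X * u)
  distrib = solve-∀

evalPoly-scalePoly : ∀ c p X Y → evalPoly (scalePoly c p) X Y ≡ c * evalPoly p X Y
evalPoly-scalePoly c []      X Y = sym (ℤₚ.*-zeroʳ c)
evalPoly-scalePoly c (r ∷ p) X Y rewrite evalRow-scale c r X | evalPoly-scalePoly c p X Y =
  distrib c (evalRow r X) Y (evalPoly p X Y)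
  where
  distrib : ∀ c a Y u → c * a + Y * (c * u) ≡ c * (a + Y * u)
  distrib = solve-∀

evalPoly-mulX : ∀ p X Y → evalPoly (mulX p) X Y ≡ X * evalPoly p X Y
evalPoly-mulX []      X Y = sym (ℤₚ.*-zeroʳ X)
evalPoly-mulX (r ∷ p) X Y rewrite evalPoly-mulX p X Y = distrib X (evalRow r X) Y (evalPoly p X Y)
  where
  distrib : ∀ X a Y u → + 0 + X * a + Y * (X * u) ≡ X * (a + Y * u)
  distrib = solve-∀

evalPoly-linMul : ∀ v p X Y → evalPoly (linMul v p) X Y ≡ (proj₁ v * X + proj₂ v * Y) * evalPoly p X Y
evalPoly-linMul (c , d) p X Y
  rewrite evalPoly-addPoly (scalePoly c (mulX p)) (scalePoly d (mulY p)) X Y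
        | evalPoly-scalePoly c (mulX p) X Y | evalPoly-scalePoly d (mulY p) X Y | evalPoly-mulX p X Y =
  distrib c d X Y (evalPoly p X Y)
  where
  distrib : ∀ c d X Y u → c * (X * u) + d * (+ 0 + Y * u) ≡ (c * X + d * Y) * u
  distrib = solve-∀

evalPoly-one : ∀ X Y → evalPoly onePoly X Y ≡ + 1
evalPoly-one X Y = one X Y
  where
  one : ∀ X Y → + 1 + X * + 0 + Y * + 0 ≡ + 1
  one = solve-∀

evalRow-isZero : ∀ r → isZeroRow r ≡ true → ∀ X → evalRow r X ≡ + 0
evalRow-isZero []           _ X = refl
evalRow-isZero (+ zero ∷ r) z X rewrite evalRow-isZero r z X = trans (ℤₚ.+-identityˡ _) (ℤₚ.*-zeroʳ X)

evalPoly-isZero : ∀ p → isZeroPoly p ≡ true → ∀ X Y → evalPoly p X Y ≡ + 0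
evalPoly-isZero []      _ X Y = refl
evalPoly-isZero (r ∷ p) z X Y with isZeroRow r in zr | isZeroPoly p in zp
evalPoly-isZero (r ∷ p) refl X Y | true | true
  rewrite evalRow-isZero r zr X | evalPoly-isZero p zp X Y = trans (ℤₚ.+-identityˡ _) (ℤₚ.*-zeroʳ Y)

infix 4 _≟ᵂ_
_≟ᵂ_ : DecidableEquality (List Bool)
_≟ᵂ_ = ≡-dec _≟ᴮ_

δ : List Bool → List Bool → ℤ
δ z y = if does (z ≟ᵂ y) then + 1 else + 0

δ-*-refl : ∀ z g → δ z z * g ≡ g
δ-*-refl z g rewrite dec-true (z ≟ᵂ z) refl = ℤₚ.*-identityˡ g

δ-*-≢ : ∀ {z y} → z ≢ y → ∀ g → δ z y * g ≡ + 0
δ-*-≢ {z} {y} z≢y g rewrite dec-false (z ≟ᵂ y) z≢y = ℤₚ.*-zeroˡ g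

∑ᴸ-δ-zero : ∀ z L (g : List Bool → ℤ) → g z ≡ + 0 → ∑ᴸ L (λ y → δ z y * g y) ≡ + 0
∑ᴸ-δ-zero z L g gz≡0 = ∑ᴸ-zero L _ term
  where
  term : ∀ y → δ z y * g y ≡ + 0
  term y with z ≟ᵂ y
  ... | yes refl = trans (ℤₚ.*-identityˡ (g z)) gz≡0
  ... | no _     = ℤₚ.*-zeroˡ (g y)

flips-injective : ∀ {b b′} k → flips b k ≡ flips b′ k → b ≡ b′
flips-injective zero    eq = eq
flips-injective (suc k) eq = flips-injective k (not-injective eq)

alternating-true≢false : ∀ k → alternating true (suc k) ≢ alternating false (suc k)
alternating-true≢false k eq with flips-injective k (∷-injectiveˡ eq)
... | ()

alternatingWords : ℕ → List (List Bool)
alternatingWords zero    = []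
alternatingWords (suc k) = alternating true (suc k) ∷ alternating false (suc k) ∷ alternatingWords k

shortAlternating : ℕ → List (List Bool)
shortAlternating m = [] ∷ alternatingWords m

∑-alternatingWords-absent : ∀ n z (g : List Bool → ℤ) → length z ≡ 0 ⊎ n < length z →
                            ∑ᴸ (alternatingWords n) (λ y → δ z y * g y) ≡ + 0
∑-alternatingWords-absent zero    z g _   = refl
∑-alternatingWords-absent (suc n) z g out =
  cong₂ _+_ (δ-*-≢ (≢alternating true) _) (cong₂ _+_ (δ-*-≢ (≢alternating false) _) (∑-alternatingWords-absent n z g out′))
  where
  ≢alternating : ∀ b → z ≢ alternating b (suc n)
  ≢alternating b z≡ = [ (λ |z|≡0 → ℕₚ.0≢1+n (trans (sym |z|≡0) |z|≡1+n))
                      , (λ n<|z| → ℕₚ.<-irrefl (sym |z|≡1+n) n<|z|) ] out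
    where
    |z|≡1+n = trans (cong length z≡) (length-alternating b (suc n))
  out′ : length z ≡ 0 ⊎ n < length z
  out′ = map₂ (ℕₚ.<-trans (ℕₚ.n<1+n n)) out

∑-alternatingWords-present : ∀ n b k (g : List Bool → ℤ) → 0 < k → k ≤ n →
                             ∑ᴸ (alternatingWords n) (λ y → δ (alternating b k) y * g y) ≡ g (alternating b k)
∑-alternatingWords-present zero    b (suc k) g 0<k ()
∑-alternatingWords-present (suc n) b k g 0<k k≤1+n with ℕₚ.m≤n⇒m<n∨m≡n k≤1+n
... | inj₁ k<1+n =
  trans (cong₂ _+_ (δ-*-≢ (≢alternating true) _) (cong₂ _+_ (δ-*-≢ (≢alternating false) _)
                   (∑-alternatingWords-present n b k g 0<k (ℕₚ.≤-pred k<1+n))))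
        (trans (ℤₚ.+-identityˡ _) (ℤₚ.+-identityˡ _))
  where
  ≢alternating : ∀ b′ → alternating b k ≢ alternating b′ (suc n)
  ≢alternating b′ eq =
    ℕₚ.<-irrefl (trans (sym (length-alternating b k)) (trans (cong length eq) (length-alternating b′ (suc n)))) k<1+n
... | inj₂ refl = trans (cong₂ _+_ (first b) (cong₂ _+_ (second b) rest)) (sum b)
  where
  rest = ∑-alternatingWords-absent n (alternating b (suc n)) g
           (inj₂ (subst (n <_) (sym (length-alternating b (suc n))) (ℕₚ.n<1+n n)))
  first : ∀ b → δ (alternating b (suc n)) (alternating true (suc n)) * g (alternating true (suc n))
              ≡ (if b then g (alternating b (suc n)) else + 0)
  first true  = δ-*-refl (alternating true (suc n)) _
  first false = δ-*-≢ (alternating-true≢false n ∘ sym) _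
  second : ∀ b → δ (alternating b (suc n)) (alternating false (suc n)) * g (alternating false (suc n))
               ≡ (if b then + 0 else g (alternating b (suc n)))
  second true  = δ-*-≢ (alternating-true≢false n) _
  second false = δ-*-refl (alternating false (suc n)) _
  sum : ∀ b → (if b then g (alternating b (suc n)) else + 0) + ((if b then + 0 else g (alternating b (suc n))) + + 0)
            ≡ g (alternating b (suc n))
  sum true  = ℤₚ.+-identityʳ _
  sum false = trans (ℤₚ.+-identityˡ _) (ℤₚ.+-identityʳ _)

∑-shortAlternating : ∀ m b k (g : List Bool → ℤ) → k ≤ m →
                     ∑ᴸ (shortAlternating m) (λ y → δ (alternating b k) y * g y) ≡ g (alternating b k)
∑-shortAlternating m b zero g _ =
  trans (cong₂ _+_ (ℤₚ.*-identityˡ (g [])) (∑-alternatingWords-absent m [] g (inj₁ refl))) (ℤₚ.+-identityʳ _)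
∑-shortAlternating m b (suc k) g k<m =
  trans (cong₂ _+_ (ℤₚ.*-zeroˡ (g [])) (∑-alternatingWords-present m b (suc k) g (s≤s z≤n) k<m)) (ℤₚ.+-identityˡ _)

label₂ : (aij aji : ℤ) → List Bool → Bool → ℤ²
label₂ aij aji pre b = act₂ aij aji (+ 0) (+ 0) pre (unit₂ b)

-- The sum, over the masks of rb selecting the word w, of the product of the selected labels, as a
-- polynomial in X = ev (P α_i) and Y = ev (P α_j); pre is the part of the braid word already traversed.
coeffPoly : (aij aji : ℤ) → (pre rb w : List Bool) → Poly
coeffPoly aij aji pre []       []       = onePoly
coeffPoly aij aji pre []       (_ ∷ _)  = []
coeffPoly aij aji pre (b ∷ rb) []       = coeffPoly aij aji (pre ∷ʳ b) rb []
coeffPoly aij aji pre (b ∷ rb) (b′ ∷ w) =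
  addPoly (coeffPoly aij aji (pre ∷ʳ b) rb (b′ ∷ w))
          (if does (b ≟ᴮ b′) then linMul (label₂ aij aji pre b) (coeffPoly aij aji (pre ∷ʳ b) rb w) else [])

allZero : (aij aji : ℤ) → List Bool → List (List Bool) → Bool
allZero aij aji rb []      = true
allZero aij aji rb (w ∷ L) = isZeroPoly (coeffPoly aij aji [] rb w) ∧ allZero aij aji rb L

∑ᴸ-allZero : ∀ aij aji rb L (g : List Bool → ℤ) X Y → allZero aij aji rb L ≡ true →
             ∑ᴸ L (λ w → g w * evalPoly (coeffPoly aij aji [] rb w) X Y) ≡ + 0
∑ᴸ-allZero aij aji rb []      g X Y _ = refl
∑ᴸ-allZero aij aji rb (w ∷ L) g X Y z with isZeroPoly (coeffPoly aij aji [] rb w) in zw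
∑ᴸ-allZero aij aji rb (w ∷ L) g X Y z | true
  rewrite evalPoly-isZero (coeffPoly aij aji [] rb w) zw X Y | ∑ᴸ-allZero aij aji rb L g X Y z =
  trans (ℤₚ.+-identityʳ _) (ℤₚ.*-zeroʳ (g w))

BraidPolynomials : ℤ → ℤ → ℕ → Set
BraidPolynomials aij aji m′ =
    coeffPoly aij aji [] rb [] ≡ onePoly
  × allZero aij aji rb (alternatingWords m′) ≡ true
  × isZeroPoly (addPoly (coeffPoly aij aji [] rb (alternating true m))
                        (coeffPoly aij aji [] rb (alternating false m))) ≡ true
  where
  m  = suc m′
  rb = braidWord m

braidPolynomials : ∀ {aij aji m′} → FiniteType aij aji (suc m′) → BraidPolynomials aij aji m′
braidPolynomials A₁×A₁ = refl , refl , refl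
braidPolynomials A₂    = refl , refl , refl
braidPolynomials B₂    = refl , refl , refl
braidPolynomials C₂    = refl , refl , refl
braidPolynomials G₂    = refl , refl , refl
braidPolynomials G₂′   = refl , refl , refl

module BraidTrivial {N : ℕ} (A : Matrix N) (diag : ∀ i → A i i ≡ + 2) (x : Fin N → ℤ)
                    (i j : Fin N) {aij aji : ℤ} (Aij≡aij : A i j ≡ aij) (Aji≡aji : A j i ≡ aji) where

  open Action A
  open Words A
  open MaskSums A x
  open Dihedral A i j
  open RankTwo A diag i j Aij≡aij Aji≡aji

  maskedLetters : (rb : List Bool) → Vec Bool (length (Letters rb)) → List Bool
  maskedLetters []       []          = []
  maskedLetters (b ∷ rb) (true ∷ ε)  = b ∷ maskedLetters rb ε
  maskedLetters (b ∷ rb) (false ∷ ε) = maskedLetters rb ε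

  masked-Letters : ∀ rb ε → masked (Letters rb) ε ≡ Letters (maskedLetters rb ε)
  masked-Letters []       []          = refl
  masked-Letters (b ∷ rb) (true ∷ ε)  = cong (letter b ∷_) (masked-Letters rb ε)
  masked-Letters (b ∷ rb) (false ∷ ε) = masked-Letters rb ε

  module At (P : Word) where

    X Y : ℤ
    X = ev (act A P (e i)) x
    Y = ev (act A P (e j)) x

    ev-label : ∀ pre b → ev (act A (P ++ Letters pre) (e (letter b))) x
                         ≡ proj₁ (label₂ aij aji pre b) * X + proj₂ (label₂ aij aji pre b) * Y
    ev-label pre b = begin
      ev (act A (P ++ Letters pre) (e (letter b))) x
        ≡⟨ ev-cong (λ t → trans (act-++ P (Letters pre) _ t) (act-cong P (act-e-span pre b) t)) x ⟩
      ev (act A P (linComb c (e i) d (e j))) x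
        ≡⟨ ev-cong (act-linComb P c (e i) d (e j)) x ⟩
      ev (linComb c (act A P (e i)) d (act A P (e j))) x
        ≡⟨ ev-linComb c _ d _ x ⟩
      c * X + d * Y ∎
      where
      open ≡-Reasoning
      c = proj₁ (label₂ aij aji pre b)
      d = proj₂ (label₂ aij aji pre b)

    prefix-∷ʳ : ∀ pre b → SameAction ((P ++ Letters pre) ∷ʳ letter b) (P ++ Letters (pre ∷ʳ b))
    prefix-∷ʳ pre b =
      SameAction-≡ (trans (++-assoc P (Letters pre) (letter b ∷ [])) (cong (P ++_) (sym (map-++ letter pre (b ∷ [])))))

    skipped : ∀ pre b rb w →
      ∑ᴹ (length (Letters rb)) (λ ε → δ (maskedLetters rb ε) w * Ψ ((P ++ Letters pre) ∷ʳ letter b) (Letters rb) ε)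
        ≡ evalPoly (coeffPoly aij aji (pre ∷ʳ b) rb w) X Y
    coeffPoly-correct : ∀ pre rb w →
      ∑ᴹ (length (Letters rb)) (λ ε → δ (maskedLetters rb ε) w * Ψ (P ++ Letters pre) (Letters rb) ε)
        ≡ evalPoly (coeffPoly aij aji pre rb w) X Y
    coeffPoly-correct pre []       []      = sym (evalPoly-one X Y)
    coeffPoly-correct pre []       (_ ∷ _) = refl
    coeffPoly-correct pre (b ∷ rb) []      =
      trans (∑ᴹ-suc (length (Letters rb)) (λ ε → δ (maskedLetters (b ∷ rb) ε) [] * Ψ′ ε))
        (trans (cong₂ _+_ (skipped pre b rb []) (∑ᴹ-zero (length (Letters rb)) _ (λ ε → ℤₚ.*-zeroˡ (Ψ′ (true ∷ ε)))))
               (ℤₚ.+-identityʳ _))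
      where
      Ψ′ = Ψ (P ++ Letters pre) (Letters (b ∷ rb))
    coeffPoly-correct pre (b ∷ rb) (b′ ∷ w) =
      trans (∑ᴹ-suc n (λ ε → δ (maskedLetters (b ∷ rb) ε) (b′ ∷ w) * Ψ (P ++ Letters pre) (Letters (b ∷ rb)) ε))
        (trans (cong₂ _+_ (skipped pre b rb (b′ ∷ w)) selected)
               (sym (evalPoly-addPoly (coeffPoly aij aji (pre ∷ʳ b) rb (b′ ∷ w)) _ X Y)))
      where
      n = length (Letters rb)
      lb = ev (act A (P ++ Letters pre) (e (letter b))) x
      selected : ∑ᴹ n (λ ε → δ (b ∷ maskedLetters rb ε) (b′ ∷ w) * (lb * Ψ ((P ++ Letters pre) ∷ʳ letter b) (Letters rb) ε))
                 ≡ evalPoly (if does (b ≟ᴮ b′) then linMul (label₂ aij aji pre b) (coeffPoly aij aji (pre ∷ʳ b) rb w)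
                                                 else []) X Y
      selected with b ≟ᴮ b′
      ... | no _     = ∑ᴹ-zero n _ (λ ε → ℤₚ.*-zeroˡ (lb * Ψ ((P ++ Letters pre) ∷ʳ letter b) (Letters rb) ε))
      ... | yes refl = begin
        ∑ᴹ n (λ ε → δ (maskedLetters rb ε) w * (lb * Ψ ((P ++ Letters pre) ∷ʳ letter b) (Letters rb) ε))
          ≡⟨ ∑ᴹ-cong n (λ ε → swap (δ (maskedLetters rb ε) w) lb _) ⟩
        ∑ᴹ n (λ ε → lb * (δ (maskedLetters rb ε) w * Ψ ((P ++ Letters pre) ∷ʳ letter b) (Letters rb) ε))
          ≡⟨ sym (*-distribˡ-∑ᴹ n lb _) ⟩
        lb * ∑ᴹ n (λ ε → δ (maskedLetters rb ε) w * Ψ ((P ++ Letters pre) ∷ʳ letter b) (Letters rb) ε)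
          ≡⟨ cong₂ _*_ (ev-label pre b) (skipped pre b rb w) ⟩
        (proj₁ (label₂ aij aji pre b) * X + proj₂ (label₂ aij aji pre b) * Y)
          * evalPoly (coeffPoly aij aji (pre ∷ʳ b) rb w) X Y
          ≡⟨ sym (evalPoly-linMul (label₂ aij aji pre b) (coeffPoly aij aji (pre ∷ʳ b) rb w) X Y) ⟩
        evalPoly (linMul (label₂ aij aji pre b) (coeffPoly aij aji (pre ∷ʳ b) rb w)) X Y ∎
        where
        open ≡-Reasoning
        swap : ∀ a l p → a * (l * p) ≡ l * (a * p)
        swap = solve-∀

    skipped pre b rb w =
      trans (∑ᴹ-cong _ (λ ε → cong (δ (maskedLetters rb ε) w *_) (Ψ-cong (prefix-∷ʳ pre b) (Letters rb) ε)))
            (coeffPoly-correct (pre ∷ʳ b) rb w)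

  ∑-by-selected-word : ∀ rb L P T → (∀ z → T (Letters z) ≡ ∑ᴸ L (λ w → δ z w * T (Letters w))) →
    ∑ᴹ (length (Letters rb)) (λ ε → Ψ P (Letters rb) ε * T (masked (Letters rb) ε))
      ≡ ∑ᴸ L (λ w → T (Letters w) * evalPoly (coeffPoly aij aji [] rb w) (At.X P) (At.Y P))
  ∑-by-selected-word rb L P T T-through-L = begin
    ∑ᴹ n (λ ε → Ψ′ ε * T (masked (Letters rb) ε))
      ≡⟨ ∑ᴹ-cong n (λ ε → cong (Ψ′ ε *_) (trans (cong T (masked-Letters rb ε)) (T-through-L (maskedLetters rb ε)))) ⟩
    ∑ᴹ n (λ ε → Ψ′ ε * ∑ᴸ L (λ w → δ (maskedLetters rb ε) w * g w))
      ≡⟨ ∑ᴹ-cong n (λ ε → trans (*-distribˡ-∑ᴸ L (Ψ′ ε) _)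
                                (∑ᴸ-cong L (λ w → rearrange (Ψ′ ε) (δ (maskedLetters rb ε) w) (g w)))) ⟩
    ∑ᴹ n (λ ε → ∑ᴸ L (λ w → g w * (δ (maskedLetters rb ε) w * Ψ′ ε)))
      ≡⟨ ∑ᴸ-comm (allMasks n) L (λ ε w → g w * (δ (maskedLetters rb ε) w * Ψ′ ε)) ⟩
    ∑ᴸ L (λ w → ∑ᴹ n (λ ε → g w * (δ (maskedLetters rb ε) w * Ψ′ ε)))
      ≡⟨ ∑ᴸ-cong L (λ w → sym (*-distribˡ-∑ᴹ n (g w) _)) ⟩
    ∑ᴸ L (λ w → g w * ∑ᴹ n (λ ε → δ (maskedLetters rb ε) w * Ψ′ ε))
      ≡⟨ ∑ᴸ-cong L (λ w → cong (g w *_) (trans (∑ᴹ-cong n (λ ε → cong (δ (maskedLetters rb ε) w *_)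
                                          (Ψ-cong (λ μ t → sym (act-++ P [] μ t)) (Letters rb) ε)))
                                          (At.coeffPoly-correct P [] rb w))) ⟩
    ∑ᴸ L (λ w → g w * evalPoly (coeffPoly aij aji [] rb w) (At.X P) (At.Y P)) ∎
    where
    open ≡-Reasoning
    n = length (Letters rb)
    Ψ′ = Ψ P (Letters rb)
    g : List Bool → ℤ
    g w = T (Letters w)
    rearrange : ∀ p d g → p * (d * g) ≡ g * (d * p)
    rearrange = solve-∀

  module _ (m′ : ℕ) (R : Relator A (rep (suc m′) (i ∷ j ∷ []))) (polys : BraidPolynomials aij aji m′) where

    open Braid m′ R using (m; braid-alternating; Reducible-alternating)

    -- A word in s_i, s_j is either reducible or equal to an alternating word of length at most m.
    TestFunction-shortAlternating : ∀ T → TestFunction T → ∀ z →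
      T (Letters z) ≡ ∑ᴸ (shortAlternating m) (λ w → δ z w * T (Letters w))
    TestFunction-shortAlternating T (_ , T-reducible) z with square-or-alternating z
    ... | inj₁ has-square = vanishing (T-reducible _ (Reducible-square z has-square))
      where
      vanishing : T (Letters z) ≡ + 0 → _
      vanishing T≡0 = trans T≡0 (sym (∑ᴸ-δ-zero z (shortAlternating m) (T ∘ Letters) T≡0))
    ... | inj₂ (b , z≡alt) = subst (λ z → T (Letters z) ≡ ∑ᴸ (shortAlternating m) (λ w → δ z w * T (Letters w)))
                                   (sym z≡alt) (alternating-case (length z))
      where
      alternating-case : ∀ k → T (Letters (alternating b k))
                               ≡ ∑ᴸ (shortAlternating m) (λ w → δ (alternating b k) w * T (Letters w))
      alternating-case k with k ℕₚ.≤? m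
      ... | yes k≤m = sym (∑-shortAlternating m b k (T ∘ Letters) k≤m)
      ... | no k≰m  = trans T≡0 (sym (∑ᴸ-δ-zero (alternating b k) (shortAlternating m) (T ∘ Letters) T≡0))
        where
        T≡0 = T-reducible _ (Reducible-alternating b k (ℕₚ.≰⇒> k≰m))

    braidWord-trivial : LocallyTrivial (Letters (braidWord m))
    braidWord-trivial P T test@(T-≈ , _) = begin
      ∑ᴹ (length (Letters rb)) (λ ε → Ψ P (Letters rb) ε * T (masked (Letters rb) ε))
        ≡⟨ ∑-by-selected-word rb (shortAlternating m) P T (TestFunction-shortAlternating T test) ⟩
      F [] + (F altᵗ + (F altᶠ + ∑ᴸ (alternatingWords m′) F))
        ≡⟨ cong (λ s → F [] + (F altᵗ + (F altᶠ + s))) (∑ᴸ-allZero aij aji rb (alternatingWords m′) g X Y all-zero) ⟩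
      F [] + (F altᵗ + (F altᶠ + + 0))
        ≡⟨ cong (λ t → F [] + (F altᵗ + (t * pᶠ + + 0))) (sym gᵗ≡gᶠ) ⟩
      g [] * evalPoly (coeffPoly aij aji [] rb []) X Y + (g altᵗ * pᵗ + (g altᵗ * pᶠ + + 0))
        ≡⟨ cong₂ (λ p q → g [] * evalPoly p X Y + q) empty-one (factor (g altᵗ) pᵗ pᶠ) ⟩
      g [] * evalPoly onePoly X Y + g altᵗ * (pᵗ + pᶠ)
        ≡⟨ cong₂ (λ p q → g [] * p + g altᵗ * q) (evalPoly-one X Y)
                 (trans (sym (evalPoly-addPoly (coeffPoly aij aji [] rb altᵗ) (coeffPoly aij aji [] rb altᶠ) X Y))
                        (evalPoly-isZero (addPoly (coeffPoly aij aji [] rb altᵗ) (coeffPoly aij aji [] rb altᶠ))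
                                         top-zero X Y)) ⟩
      g [] * + 1 + g altᵗ * + 0
        ≡⟨ simplify (g []) (g altᵗ) ⟩
      T [] ∎
      where
      open ≡-Reasoning
      rb = braidWord m
      altᵗ = alternating true m
      altᶠ = alternating false m
      X = At.X P
      Y = At.Y P
      empty-one = proj₁ polys
      all-zero  = proj₁ (proj₂ polys)
      top-zero  = proj₂ (proj₂ polys)
      g : List Bool → ℤ
      g w = T (Letters w)
      F : List Bool → ℤ
      F w = g w * evalPoly (coeffPoly aij aji [] rb w) X Y
      pᵗ = evalPoly (coeffPoly aij aji [] rb altᵗ) X Y
      pᶠ = evalPoly (coeffPoly aij aji [] rb altᶠ) X Y
      gᵗ≡gᶠ : g altᵗ ≡ g altᶠ
      gᵗ≡gᶠ = T-≈ _ _ (braid-alternating true)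
                     (trans (length-Letters-alternating true m) (sym (length-Letters-alternating false m)))
      factor : ∀ g a b → g * a + (g * b + + 0) ≡ g * (a + b)
      factor = solve-∀
      simplify : ∀ a b → a * + 1 + b * + 0 ≡ a
      simplify = solve-∀

  braid-trivial : ∀ {m} → FiniteType aij aji m → Relator A (rep m (i ∷ j ∷ [])) → LocallyTrivial (rep m (i ∷ j ∷ []))
  braid-trivial t R with FiniteType-order t
  ... | m′ , refl = subst LocallyTrivial (Letters-braidWord (suc m′)) (braidWord-trivial m′ R (braidPolynomials t))

-- Positivity of roots

linComb-nonneg : ∀ {c a d b : ℤ} → + 0 ℤ.≤ c → + 0 ℤ.≤ a → + 0 ℤ.≤ d → + 0 ℤ.≤ b → + 0 ℤ.≤ c * a + d * b
linComb-nonneg c≥0 a≥0 d≥0 b≥0 = ℤₚ.+-mono-≤ (0≤* c≥0 a≥0) (0≤* d≥0 b≥0)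
  where
  0≤* : ∀ {c a : ℤ} → + 0 ℤ.≤ c → + 0 ℤ.≤ a → + 0 ℤ.≤ c * a
  0≤* {+ c} {+ a} _ _ = subst (+ 0 ℤ.≤_) (ℤₚ.pos-* c a) (+≤+ z≤n)

module Positivity {N : ℕ} (A : Matrix N) (gcm : IsGCM A) (dec : ∀ u v → Dec (_≃_ A u v)) where

  open Action A
  open Words A

  ¬ends-with : ∀ {w u i L} → IsLength A (w ∷ʳ i) (suc L) → u ∷ʳ i ≈ w → length u < suc L → ⊥
  ¬ends-with {u = u} {i} ℓwi ui≈w shorter =
    IsLength-no-shorter ℓwi (≃trans (≃sym (cancel-∷ʳ-∷ʳ u i)) (≈-congʳ (i ∷ []) ui≈w)) shorter

  PositiveBelow : ℕ → Set
  PositiveBelow n = ∀ {L} w i → L < n → IsLength A w L → IsLength A (w ∷ʳ i) (suc L) → Positive A (act A w (e i))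

  -- w = v y with y in the dihedral group of the last letter j of w and of i, and ℓ(v) minimal:
  -- then v s_i and v s_j are both longer than v, and y α_i is a nonnegative combination of α_i and α_j.
  module Step (L′ : ℕ) (IH : PositiveBelow (suc L′)) (w : Word) (i : Fin N)
              (ℓw : IsLength A w (suc L′)) (ℓwi : IsLength A (w ∷ʳ i) (suc (suc L′))) where

    L : ℕ
    L = suc L′

    last-letter : ∃₂ λ z₀ j → z₀ ∷ʳ j ≈ w × length z₀ ≡ L′
    last-letter = split (proj₁ (proj₁ ℓw)) (proj₁ (proj₂ (proj₁ ℓw))) (proj₂ (proj₂ (proj₁ ℓw)))
      where
      split : ∀ z → length z ≡ L → z ≈ w → ∃₂ λ z₀ j → z₀ ∷ʳ j ≈ w × length z₀ ≡ L′
      split z |z|≡L z≈w with initLast z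
      ... | []       = contradiction |z|≡L λ ()
      ... | z₀ ∷ʳ′ j = z₀ , j , z≈w , ℕₚ.suc-injective (trans (sym (length-∷ʳ z₀ j)) |z|≡L)

    z₀ : Word
    z₀ = proj₁ last-letter

    j : Fin N
    j = proj₁ (proj₂ last-letter)

    z₀j≈w : z₀ ∷ʳ j ≈ w
    z₀j≈w = proj₁ (proj₂ (proj₂ last-letter))

    |z₀|≡L′ : length z₀ ≡ L′
    |z₀|≡L′ = proj₂ (proj₂ (proj₂ last-letter))

    i≢j : ¬ i ≡ j
    i≢j i≡j = ¬ends-with ℓwi (subst (λ k → z₀ ∷ʳ k ≈ w) (sym i≡j) z₀j≈w)
                             (subst (_< suc L) (sym |z₀|≡L′) (ℕₚ.<-trans (ℕₚ.n<1+n L′) (ℕₚ.n<1+n L)))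

    open Dihedral A i j

    Decomposition : ℕ → Set
    Decomposition k = k ≤ L × ∃ λ v → length v ≡ k × ∃ λ y → length y ≡ L ∸ k × v ++ Letters y ≈ w

    Decomposition? : ∀ k → Dec (Decomposition k)
    Decomposition? k = (k ℕₚ.≤? L) ×-dec
      ∃-ofLength? Finₚ.any? (λ v → ∃-ofLength? any?-Bool (λ y → dec (v ++ Letters y) w) (L ∸ k)) k

    decomposition-L′ : Decomposition L′
    decomposition-L′ = ℕₚ.n≤1+n L′ , z₀ , |z₀|≡L′ , false ∷ [] , sym (ℕₚ.m+n∸n≡m 1 L′) , z₀j≈w

    module Minimal (n₀ : ℕ) (decomposition : Decomposition n₀) (n₀-minimal : ∀ k → Decomposition k → n₀ ≤ k) where

      v : Word
      v = proj₁ (proj₂ decomposition)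

      |v|≡n₀ : length v ≡ n₀
      |v|≡n₀ = proj₁ (proj₂ (proj₂ decomposition))

      y : List Bool
      y = proj₁ (proj₂ (proj₂ (proj₂ decomposition)))

      |y|≡L∸n₀ : length y ≡ L ∸ n₀
      |y|≡L∸n₀ = proj₁ (proj₂ (proj₂ (proj₂ (proj₂ decomposition))))

      vy≈w : v ++ Letters y ≈ w
      vy≈w = proj₂ (proj₂ (proj₂ (proj₂ (proj₂ decomposition))))

      n₀≤L′ : n₀ ≤ L′
      n₀≤L′ = n₀-minimal L′ decomposition-L′

      n₀≤L : n₀ ≤ L
      n₀≤L = proj₁ decomposition

      length-·y : ∀ u → length (u ++ Letters y) ≡ length u ℕ.+ (L ∸ n₀)
      length-·y u = trans (length-++ u) (cong (length u ℕ.+_) (trans (length-map letter y) |y|≡L∸n₀))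

      |v|+|y|≡L : length v ℕ.+ length y ≡ L
      |v|+|y|≡L = trans (cong₂ ℕ._+_ |v|≡n₀ |y|≡L∸n₀) (ℕₚ.m+[n∸m]≡n n₀≤L)

      ℓv : IsLength A v n₀
      ℓv = (v , |v|≡n₀ , ≃refl) , λ v′ v′≈v → ℕₚ.≮⇒≥ λ shorter →
        IsLength-no-shorter ℓw (≃trans (≈-congʳ (Letters y) v′≈v) vy≈w)
          (subst (_< L) (sym (length-·y v′))
            (subst (length v′ ℕ.+ (L ∸ n₀) <_) (ℕₚ.m+[n∸m]≡n n₀≤L) (ℕₚ.+-monoˡ-< (L ∸ n₀) shorter)))

      ℓv∷ʳ : ∀ b → IsLength A (v ∷ʳ letter b) (suc n₀)
      ℓv∷ʳ b with ∃-IsLength dec (v ∷ʳ letter b)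
      ... | c , ℓvb with IsLength-∷ʳ ℓv ℓvb
      ...   | inj₁ c≡1+n₀ = subst (IsLength A (v ∷ʳ letter b)) c≡1+n₀ ℓvb
      ...   | inj₂ n₀≡1+c = ⊥-elim (ℕₚ.<-irrefl refl (subst (_≤ c) n₀≡1+c (n₀-minimal c shorter-decomposition)))
        where
        v″ = proj₁ (proj₁ ℓvb)
        v″≈vb = proj₂ (proj₂ (proj₁ ℓvb))
        1+c≤L : suc c ≤ L
        1+c≤L = subst (_≤ L) n₀≡1+c n₀≤L
        shorter-decomposition : Decomposition c
        shorter-decomposition =
          ℕₚ.<⇒≤ 1+c≤L , v″ , proj₁ (proj₂ (proj₁ ℓvb)) , b ∷ y ,
          trans (cong suc |y|≡L∸n₀) (trans (cong (λ n → suc (L ∸ n)) n₀≡1+c) (sym (ℕₚ.+-∸-assoc 1 1+c≤L))) ,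
          ≃trans (subst₂ _≈_ (++-assoc v″ (letter b ∷ []) (Letters y)) refl
                   (≈-congʳ (Letters y) (≃trans (≈-congʳ (letter b ∷ []) v″≈vb) (cancel-∷ʳ-∷ʳ v (letter b)))))
                 vy≈w

      positive-v : ∀ b → Positive A (act A v (e (letter b)))
      positive-v b = IH v (letter b) (ℕₚ.≤-<-trans n₀≤L′ (ℕₚ.n<1+n L′)) ℓv (ℓv∷ʳ b)

      |v·y|≡L : length (v ++ Letters y) ≡ L
      |v·y|≡L = trans (length-·y v) (trans (cong (ℕ._+ (L ∸ n₀)) |v|≡n₀) (ℕₚ.m+[n∸m]≡n n₀≤L))

      K : ℕ
      K = L′ ∸ n₀

      |y|≡1+K : length y ≡ suc K
      |y|≡1+K = trans |y|≡L∸n₀ (ℕₚ.+-∸-assoc 1 n₀≤L′)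

      ¬y-ends-with-i : ∀ u → Letters y ≈ u ∷ʳ i → suc (length u) ≡ length y → ⊥
      ¬y-ends-with-i u y≈ui 1+|u|≡|y| = ¬ends-with ℓwi vui≈w shorter
        where
        vui≈w : (v ++ u) ∷ʳ i ≈ w
        vui≈w = ≃trans (subst₂ _≈_ (sym (++-assoc v u (i ∷ []))) refl (≈-congˡ v (≃sym y≈ui))) vy≈w
        shorter : length (v ++ u) < suc L
        shorter = subst (_< suc L) (sym (length-++ v))
          (ℕₚ.<-trans (ℕₚ.≤-reflexive (trans (sym (ℕₚ.+-suc (length v) (length u)))
                                              (trans (cong (length v ℕ.+_) 1+|u|≡|y|) |v|+|y|≡L)))
                      (ℕₚ.n<1+n L))

      alternating-false-coordinates : y ≡ alternating false (suc K) → NonNeg₂ (alternatingRoot (A i j) (A j i) (suc K))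
      alternating-false-coordinates y≡alt with coxM (A i j * A j i) in eq
      ... | nothing with infiniteType (cartanPair gcm i≢j) eq
      ...   | a , b , Aij≡ , Aji≡ , 4≤ab = subst₂ (λ x y → NonNeg₂ (alternatingRoot x y (suc K))) (sym Aij≡) (sym Aji≡)
                                                  (InfiniteType.alternatingRoot-infinite a b 4≤ab (suc K))
      alternating-false-coordinates y≡alt | just m with finiteType (cartanPair gcm i≢j) eq | suc K ℕₚ.<? m
      ... | t | yes 1+K<m = alternatingRoot-finite t 1+K<m
      ... | t | no 1+K≮m with FiniteType-order t
      ...   | m′ , refl with Braid.alternating-≈-∷ʳ-i m′ (braid i j (suc m′) i≢j eq) (suc K) (ℕₚ.≮⇒≥ 1+K≮m)
      ...     | u , alt≈ui , 1+|u|≡1+K =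
        ⊥-elim (¬y-ends-with-i u (subst (λ y′ → Letters y′ ≈ u ∷ʳ i) (sym y≡alt) alt≈ui) (trans 1+|u|≡1+K (sym |y|≡1+K)))

      y-coordinates : NonNeg₂ (act₂ (A i j) (A j i) (+ 0) (+ 0) y (unit₂ true))
      y-coordinates with square-or-alternating y
      ... | inj₁ has-square with Reducible-infix v [] (Reducible-square y has-square)
      ...   | z′ , vy≈z′ , shorter = ⊥-elim (IsLength-no-shorter ℓw
              (≃trans (≃sym vy≈z′) (subst (_≈ w) (cong (v ++_) (sym (++-identityʳ _))) vy≈w))
              (subst (length z′ <_) (trans (cong (λ u → length (v ++ u)) (++-identityʳ _)) |v·y|≡L) shorter))
      y-coordinates | inj₂ (true , y≡alt) = ⊥-elim (¬y-ends-with-i (Letters (alternating false K)) y≈ui 1+|u|≡|y|)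
        where
        y≡ : y ≡ alternating false K ∷ʳ true
        y≡ = trans y≡alt (trans (cong (alternating true) |y|≡1+K) (alternating-∷ʳ true K))
        y≈ui : Letters y ≈ Letters (alternating false K) ∷ʳ i
        y≈ui = subst (Letters y ≈_) (trans (cong Letters y≡) (map-++ letter (alternating false K) (true ∷ []))) ≃refl
        1+|u|≡|y| : suc (length (Letters (alternating false K))) ≡ length y
        1+|u|≡|y| = trans (cong suc (length-Letters-alternating false K)) (sym |y|≡1+K)
      y-coordinates | inj₂ (false , y≡alt) =
        subst (λ y′ → NonNeg₂ (act₂ (A i j) (A j i) (+ 0) (+ 0) y′ (unit₂ true))) (sym y≡)
              (alternating-false-coordinates y≡)
        where
        y≡ : y ≡ alternating false (suc K)
        y≡ = trans y≡alt (cong (alternating false) |y|≡1+K)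

      result : Positive A (act A w (e i))
      result t = subst (+ 0 ℤ.≤_) (sym expand)
        (linComb-nonneg (proj₁ y-coordinates) (positive-v true t) (proj₂ y-coordinates) (positive-v false t))
        where
        cd = act₂ (A i j) (A j i) (+ 0) (+ 0) y (unit₂ true)
        expand : act A w (e i) t ≡ proj₁ cd * act A v (e i) t + proj₂ cd * act A v (e j) t
        expand = begin
          act A w (e i) t                          ≡⟨ sym (act-≈ A gcm vy≈w (e i) t) ⟩
          act A (v ++ Letters y) (e i) t           ≡⟨ act-++ v (Letters y) (e i) t ⟩
          act A v (act A (Letters y) (e i)) t      ≡⟨ act-cong v (RankTwo.act-e-span A (proj₁ gcm) i j refl refl y true) t ⟩
          act A v (linComb (proj₁ cd) (e i) (proj₂ cd) (e j)) t ≡⟨ act-linComb v (proj₁ cd) (e i) (proj₂ cd) (e j) t ⟩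
          proj₁ cd * act A v (e i) t + proj₂ cd * act A v (e j) t ∎
          where open ≡-Reasoning

    result : Positive A (act A w (e i))
    result with minimal Decomposition? decomposition-L′
    ... | n₀ , decomposition , n₀-minimal = Minimal.result n₀ decomposition n₀-minimal

  positivity : ∀ {L} w i → IsLength A w L → IsLength A (w ∷ʳ i) (suc L) → Positive A (act A w (e i))
  positivity {L} = go L (<-wellFounded L)
    where
    go : ∀ L → Acc _<_ L → ∀ w i → IsLength A w L → IsLength A (w ∷ʳ i) (suc L) → Positive A (act A w (e i))
    go zero     _             w i (([] , _ , []≈w) , _) _ t = subst (+ 0 ℤ.≤_) (act-≈ A gcm []≈w (e i) t) (e-nonneg i t)
    go (suc L′) (acc smaller) w i ℓw ℓwi = Step.result L′ (λ w i L<1+L′ → go _ (smaller L<1+L′) w i) w i ℓw ℓwi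

  private
    0≤i∧0≤-i⇒i≡0 : ∀ {r} → + 0 ℤ.≤ r → + 0 ℤ.≤ - r → r ≡ + 0
    0≤i∧0≤-i⇒i≡0 {+ zero}   _ _  = refl
    0≤i∧0≤-i⇒i≡0 {+ suc _}  _ ()
    0≤i∧0≤-i⇒i≡0 { -[1+ _ ]} () _

  ValidLabel⇒canonical : ∀ u k β → ValidLabel A u k β → β ≗ act A u (e k)
  ValidLabel⇒canonical u k β (sign , forward⇒positive , backward⇒negative)
    with ∃-IsLength dec u | ∃-IsLength dec (u ∷ʳ k)
  ... | a , ℓu | b , ℓuk with IsLength-∷ʳ ℓu ℓuk
  ...   | inj₁ refl = [ (λ β≡ρ → β≡ρ) , (λ β≡-ρ → ⊥-elim (act-e-nonzero (proj₁ gcm) u k λ t →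
                          0≤i∧0≤-i⇒i≡0 (ρ≥0 t) (subst (+ 0 ℤ.≤_) (β≡-ρ t) (forward⇒positive forward t)))) ] sign
    where
    forward : Forward A u k
    forward a′ b′ ℓu′ ℓuk′ rewrite IsLength-unique ℓu′ ℓu | IsLength-unique ℓuk′ ℓuk = ℕₚ.n<1+n a
    ρ≥0 : Positive A (act A u (e k))
    ρ≥0 = positivity u k ℓu ℓuk
  ...   | inj₂ refl = [ (λ β≡ρ → β≡ρ) , (λ β≡-ρ → ⊥-elim (act-e-nonzero (proj₁ gcm) u k λ t →
                          trans (sym (ℤₚ.neg-involutive _)) (cong -_ (0≤i∧0≤-i⇒i≡0 (-ρ≥0 t)
                            (ℤₚ.neg-mono-≤ (subst (ℤ._≤ + 0) (β≡-ρ t) (backward⇒negative backward t))))))) ] sign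
    where
    backward : Backward A u k
    backward a′ b′ ℓu′ ℓuk′ rewrite IsLength-unique ℓu′ ℓu | IsLength-unique ℓuk′ ℓuk = ℕₚ.n<1+n b
    -ρ≥0 : Positive A (λ t → - act A u (e k) t)
    -ρ≥0 t = subst (+ 0 ℤ.≤_) (act-∷ʳ-self (proj₁ gcm) u k t)
               (positivity (u ∷ʳ k) k ℓuk (IsLength-≈ (≃sym (cancel-∷ʳ-∷ʳ u k)) ℓu) t)

-- Invariance under the Coxeter relations

module Invariance {N : ℕ} (A : Matrix N) (gcm : IsGCM A) (x : Fin N → ℤ) where

  open Words A
  open MaskSums A x

  Relator-trivial : ∀ {r} → Relator A r → LocallyTrivial r
  Relator-trivial (square i)             = square-trivial (proj₁ gcm) i
  Relator-trivial R@(braid i j m i≢j eq) =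
    BraidTrivial.braid-trivial A (proj₁ gcm) x i j refl refl (Relator-finiteType A gcm i≢j eq) R

  module _ (dec : ∀ u v → Dec (u ≈ v)) (v : Word) (l : ℕ) (ℓv≡l : IsLength A v l) where

    open Weighted dec v l ℓv≡l

    weightedSum-≈ : ∀ {u w} → u ≈ w → weightedSum u ≡ weightedSum w
    weightedSum-≈ (del p r q R)  = weightedSum-delete p r q (Relator-trivial R) (act-Relator A gcm R)
    weightedSum-≈ ≃refl          = refl
    weightedSum-≈ (≃sym p)       = sym (weightedSum-≈ p)
    weightedSum-≈ (≃trans p q)   = trans (weightedSum-≈ p) (weightedSum-≈ q)

proposition3p2 : (k : ℕ) (A : Matrix (suc k)) → AffineCartan A →
    (dec : (u v : List (Fin (suc k))) → Dec (_≃_ A u v)) →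
    (w γ γ′ : List (Fin (suc k))) → _≃_ A γ w → _≃_ A γ′ w →
    (β : Fin (length γ) → Lat (suc k)) → ValidLabels A γ β →
    (β′ : Fin (length γ′) → Lat (suc k)) → ValidLabels A γ′ β′ →
    (v : List (Fin (suc k))) (l : ℕ) → IsLength A v l →
    (x : Fin (suc k) → ℤ) →
    maskSum A dec γ β v l x ≡ maskSum A dec γ′ β′ v l x
proposition3p2 k A (gcm , _) dec w γ γ′ γ≈w γ′≈w β valid β′ valid′ v l ℓv≡l x = begin
  maskSum A dec γ β v l x    ≡⟨ maskSum≡weightedSum γ β (canonical valid) ⟩
  weightedSum γ              ≡⟨ weightedSum-≈ dec v l ℓv≡l γ≈w ⟩
  weightedSum w              ≡⟨ weightedSum-≈ dec v l ℓv≡l γ′≈w ⟨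
  weightedSum γ′             ≡⟨ maskSum≡weightedSum γ′ β′ (canonical valid′) ⟨
  maskSum A dec γ′ β′ v l x  ∎
  where
  open ≡-Reasoning
  open Invariance A gcm x
  open MaskSums.Weighted A x dec v l ℓv≡l
  canonical : ∀ {γ β} → ValidLabels A γ β → MaskSums.CanonicalLabels A x [] γ β
  canonical valid t = Positivity.ValidLabel⇒canonical A gcm dec _ _ _ (valid t)
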